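{- Let $G=(V,E)$ be a graph and let $r\ge 1$. Suppose $H$ is an induced subgraph of $G$ isomorphic to the complete bipartite graph $K_{r,r}$, with vertex set $V(H)$ and edge set $E(H)$. Then the balanced biclique inequality \[ \sum_{v\in V(H)}x_v+\sum_{e\in E(H)}y_e\le r \] defines a facet of $P_T(G)$.
   Context: All graphs are finite, simple, loopless and undirected. For $G=(V,E)$, two elements of $V\cup E$ are adjacent if they are adjacent vertices, incident (sharing an endpoint) edges, or an edge and one of its endpoints; otherwise they are independent. A total matching is a subset $T\subseteq V\cup E$ of pairwise independent elements. The Total Matching Polytope $P_T(G)\subseteq\mathbb{R}^{|V|+|E|}$ is the convex hull of the characteristic vectors $\chi[T]=(x,y)\in\{0,1\}^{V}\times\{0,1\}^{E}$ of all total matchings $T$ ($x$ vertex coordinates, $y$ edge coordinates; a coordinate equals $1$ iff the corresponding element lies in $T$). Variables of elements outside $H$ have coefficient $0$ in the inequality. -}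

module Defs where

open import Data.Nat using (ℕ; zero; suc)
open import Data.Fin using (Fin; zero; suc)
open import Data.Sum using (_⊎_; inj₁; inj₂)
open import Data.Product using (Σ; ∃; ∃-syntax; _×_; _,_)
open import Data.Bool using (Bool; true; false; if_then_else_)
open import Data.Integer using (+_)
open import Data.Rational using (ℚ; 0ℚ; 1ℚ; _+_; _*_; _-_; _≤_; _/_)
open import Relation.Binary.PropositionalEquality using (_≡_; _≢_)
open import Relation.Nullary using (¬_)
open import Function.Definitions using (Injective)

record Graph : Set where
  field
    n m : ℕ
    src tgt : Fin m → Fin n
    loopless : ∀ e → src e ≢ tgt e
    simple : ∀ e f →
      ((src e ≡ src f × tgt e ≡ tgt f) ⊎ (src e ≡ tgt f × tgt e ≡ src f)) → e ≡ f

module _ (G : Graph) where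
  open Graph G

  Joins : Fin n → Fin n → Fin m → Set
  Joins u v e = (src e ≡ u × tgt e ≡ v) ⊎ (src e ≡ v × tgt e ≡ u)

  Endpoint : Fin n → Fin m → Set
  Endpoint v e = (src e ≡ v) ⊎ (tgt e ≡ v)

  Elt : Set
  Elt = Fin n ⊎ Fin m

  Adj : Elt → Elt → Set
  Adj (inj₁ u) (inj₁ v) = u ≢ v × ∃[ e ] Joins u v e
  Adj (inj₂ e) (inj₂ f) = e ≢ f × ∃[ v ] (Endpoint v e × Endpoint v f)
  Adj (inj₁ v) (inj₂ e) = Endpoint v e
  Adj (inj₂ e) (inj₁ v) = Endpoint v e

  TotalMatching : (Elt → Bool) → Set
  TotalMatching T = ∀ a b → T a ≡ true → T b ≡ true → a ≢ b → ¬ Adj a b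

  Pt : Set
  Pt = Elt → ℚ

  χ : (Elt → Bool) → Pt
  χ T a = if T a then 1ℚ else 0ℚ

sumFin : (k : ℕ) → (Fin k → ℚ) → ℚ
sumFin zero f = 0ℚ
sumFin (suc k) f = f zero + sumFin k (λ i → f (suc i))

ℕtoℚ : ℕ → ℚ
ℕtoℚ r = (+ r) / 1

module _ (G : Graph) where
  open Graph G

  dot : Pt G → Pt G → ℚ
  dot c x = sumFin n (λ v → c (inj₁ v) * x (inj₁ v)) + sumFin m (λ e → c (inj₂ e) * x (inj₂ e))

  InPT : Pt G → Set
  InPT x = ∃[ k ] Σ (Fin k → (Elt G → Bool)) λ T → Σ (Fin k → ℚ) λ w →
    (∀ i → TotalMatching G (T i)) × (∀ i → 0ℚ ≤ w i) × (sumFin k w ≡ 1ℚ) ×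
    (∀ a → x a ≡ sumFin k (λ i → w i * χ G (T i) a))

  AffIndep : (k : ℕ) → (Fin (suc k) → Pt G) → Set
  AffIndep k p = ∀ (μ : Fin k → ℚ) →
    (∀ a → sumFin k (λ i → μ i * (p (suc i) a - p zero a)) ≡ 0ℚ) → ∀ i → μ i ≡ 0ℚ

  HasDim : (Pt G → Set) → ℕ → Set
  HasDim S d =
    (∃[ p ] ((∀ i → S (p i)) × AffIndep d p)) ×
    (∀ (p : Fin (suc (suc d)) → Pt G) → (∀ i → S (p i)) → ¬ AffIndep (suc d) p)

  ValidIneq : Pt G → ℚ → Set
  ValidIneq c β = ∀ x → InPT x → dot c x ≤ β

  Face : Pt G → ℚ → Pt G → Set
  Face c β x = InPT x × dot c x ≡ β

  IsFacet : Pt G → ℚ → Set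
  IsFacet c β = ValidIneq c β × ∃[ d ] (HasDim InPT (suc d) × HasDim (Face c β) d)

  InducedKrr : (r : ℕ) → (Fin r ⊎ Fin r → Fin n) → Set
  InducedKrr r f =
    Injective _≡_ _≡_ f ×
    (∀ i j → ∃[ e ] Joins G (f (inj₁ i)) (f (inj₂ j)) e) ×
    (∀ i j e → ¬ Joins G (f (inj₁ i)) (f (inj₁ j)) e) ×
    (∀ i j e → ¬ Joins G (f (inj₂ i)) (f (inj₂ j)) e)

  InHV : (r : ℕ) → (Fin r ⊎ Fin r → Fin n) → Fin n → Set
  InHV r f v = ∃[ s ] f s ≡ v

  -- elements of V(H) ∪ E(H) (H induced: E(H) = edges with both ends in V(H))
  InH : (r : ℕ) → (Fin r ⊎ Fin r → Fin n) → Elt G → Set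
  InH r f (inj₁ v) = InHV r f v
  InH r f (inj₂ e) = InHV r f (src e) × InHV r f (tgt e)

-- Validity: a total matching of K_{r,r} cannot use vertices of both sides, so it avoids one side, and
-- it meets each vertex of the other side together with its r incident edges (a clique of the total
-- graph) at most once, hence in at most r elements.
--
-- Facet: P_T(G) is full-dimensional (the empty set and the singletons), while points of the hyperplane
-- c·x = r include at most |V| + |E| affinely independent ones. We exhibit |V| + |E| total matchings
-- meeting H in exactly r elements, one for each element x of G: if x is outside H, x together with the
-- r "diagonal" edges of H (x a vertex) or with a side of H that x does not touch (x an edge); if x is in
-- H, a side of H with possibly one vertex exchanged for an incident edge. Their characteristic vectors
-- are linearly independent: a coordinate outside H sees only its own matching, and on H what remains is
-- a linear system on K_{r,r} which can be solved by hand.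

module Submission where

open import Defs

open import Algebra.Bundles using (CommutativeMonoid)
open import Data.Bool using (Bool; true; false; if_then_else_; not)
import Data.Bool as Bool
open import Data.Bool.Properties using (¬-not; ∧-zeroʳ; ∧-idem)
open import Data.Empty using (⊥; ⊥-elim)
open import Data.Fin using (Fin; zero; suc; punchIn; _↑ˡ_; _↑ʳ_; splitAt; join)
import Data.Fin.Properties as Fin
import Data.Integer as ℤ
import Data.Integer.Properties as ℤ
open import Data.Nat using (ℕ; zero; suc; _≤_; z≤n; s≤s)
import Data.Nat as ℕ
import Data.Nat.Coprimality as C
import Data.Nat.Properties as ℕ
open import Data.Product using (_×_; _,_; proj₁; proj₂; ∃-syntax)
open import Data.Rational using (ℚ; mkℚ; ↥_; nonNegative; 0ℚ; 1ℚ; _+_; _*_; _-_; -_; 1/_; ≢-nonZero; _/_)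
  renaming (_≤_ to _≤ℚ_)
import Data.Rational.Properties as ℚ
open import Data.Rational.Solver using (module +-*-Solver)
open import Data.Sum using (_⊎_; inj₁; inj₂)
import Data.Sum as ⊎
open import Data.Sum.Properties using (inj₁-injective; inj₂-injective; ≡-dec)
open import Data.Vec.Functional using (insertAt)
open import Data.Vec.Functional.Properties using (insertAt-lookup; insertAt-punchIn)
open import Function using (_∘_)
open import Relation.Binary.PropositionalEquality
open import Relation.Nullary using (¬_; ¬?; Dec; yes; no; does; _⊎-dec_)
open import Relation.Nullary.Decidable using (decidable-stable; dec-true; dec-false)

open import Algebra.Properties.CommutativeSemigroup
  (CommutativeMonoid.commutativeSemigroup ℚ.+-0-commutativeMonoid)
  using () renaming (interchange to +-interchange; x∙yz≈y∙xz to x+[y+z]≡y+[x+z])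
open +-*-Solver using (solve; _:=_; _:+_; _:*_; :-_; _:-_; con)

does-sound : ∀ {P : Set} (P? : Dec P) → does P? ≡ true → P
does-sound (yes p) _ = p

x+y≡0∧y≡0⇒x≡0 : ∀ {x y} → x + y ≡ 0ℚ → y ≡ 0ℚ → x ≡ 0ℚ
x+y≡0∧y≡0⇒x≡0 {x} x+y≡0 refl = trans (sym (ℚ.+-identityʳ x)) x+y≡0

p≢0∧p*q≡0⇒q≡0 : ∀ p q → p ≢ 0ℚ → p * q ≡ 0ℚ → q ≡ 0ℚ
p≢0∧p*q≡0⇒q≡0 p q p≢0 pq≡0 = begin
  q                ≡⟨ ℚ.*-identityˡ q ⟨
  1ℚ * q           ≡⟨ cong (_* q) (ℚ.*-inverseˡ p) ⟨
  (1/ p * p) * q   ≡⟨ ℚ.*-assoc (1/ p) p q ⟩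
  1/ p * (p * q)   ≡⟨ cong (1/ p *_) pq≡0 ⟩
  1/ p * 0ℚ        ≡⟨ ℚ.*-zeroʳ (1/ p) ⟩
  0ℚ               ∎
  where
  open ≡-Reasoning
  instance _ = ≢-nonZero p≢0

ℕtoℚ-mkℚ : ∀ k → ℕtoℚ k ≡ mkℚ (ℤ.+_ k) 0 (C.sym (C.1-coprimeTo k))
ℕtoℚ-mkℚ k = ℚ.normalize-coprime _

ℕtoℚ-suc : ∀ k → ℕtoℚ (suc k) ≡ 1ℚ + ℕtoℚ k
ℕtoℚ-suc k = begin
  ℕtoℚ (suc k)                ≡⟨ ℚ./-cong (cong (ℤ._+_ 1ℤ) (sym (ℤ.*-identityʳ (ℤ.+_ k)))) refl ⟩
  (1ℤ ℤ.+ ℤ.+_ k ℤ.* 1ℤ) / 1  ≡⟨ cong (1ℚ +_) (ℕtoℚ-mkℚ k) ⟨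
  1ℚ + ℕtoℚ k                 ∎
  where
  open ≡-Reasoning
  1ℤ = ℤ.+_ 1

ℕtoℚ-suc≢0 : ∀ k → ℕtoℚ (suc k) ≢ 0ℚ
ℕtoℚ-suc≢0 k eq with () ← cong ↥_ (trans (sym (ℕtoℚ-mkℚ (suc k))) eq)

sum-cong : ∀ k {f g : Fin k → ℚ} → (∀ i → f i ≡ g i) → sumFin k f ≡ sumFin k g
sum-cong zero    f≗g = refl
sum-cong (suc k) f≗g = cong₂ _+_ (f≗g zero) (sum-cong k (f≗g ∘ suc))

sum-zero : ∀ k {f : Fin k → ℚ} → (∀ i → f i ≡ 0ℚ) → sumFin k f ≡ 0ℚ
sum-zero k f≗0 = trans (sum-cong k f≗0) (sum-0 k)
  where
  sum-0 : ∀ k → sumFin k (λ _ → 0ℚ) ≡ 0ℚ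
  sum-0 zero    = refl
  sum-0 (suc k) = cong (0ℚ +_) (sum-0 k)

sum-+ : ∀ k (f g : Fin k → ℚ) → sumFin k (λ i → f i + g i) ≡ sumFin k f + sumFin k g
sum-+ zero    f g = refl
sum-+ (suc k) f g = trans (cong (f zero + g zero +_) (sum-+ k (f ∘ suc) (g ∘ suc)))
  (+-interchange (f zero) (g zero) _ _)

sum-*ˡ : ∀ k a (f : Fin k → ℚ) → sumFin k (λ i → a * f i) ≡ a * sumFin k f
sum-*ˡ zero    a f = sym (ℚ.*-zeroʳ a)
sum-*ˡ (suc k) a f = trans (cong (a * f zero +_) (sum-*ˡ k a (f ∘ suc)))
  (sym (ℚ.*-distribˡ-+ a (f zero) _))

sum-*ʳ : ∀ k a (f : Fin k → ℚ) → sumFin k (λ i → f i * a) ≡ sumFin k f * a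
sum-*ʳ k a f = trans (sum-cong k (λ i → ℚ.*-comm (f i) a)) (trans (sum-*ˡ k a f) (ℚ.*-comm a _))

sum-neg : ∀ k (f : Fin k → ℚ) → sumFin k (λ i → - f i) ≡ - sumFin k f
sum-neg zero    f = refl
sum-neg (suc k) f = trans (cong (- f zero +_) (sum-neg k (f ∘ suc)))
  (sym (ℚ.neg-distrib-+ (f zero) _))

sum-swap : ∀ k l (f : Fin k → Fin l → ℚ) →
  sumFin k (λ i → sumFin l (f i)) ≡ sumFin l (λ j → sumFin k (λ i → f i j))
sum-swap zero    l f = sym (sum-zero l (λ _ → refl))
sum-swap (suc k) l f = trans (cong (sumFin l (f zero) +_) (sum-swap k l (f ∘ suc)))
  (sym (sum-+ l (f zero) _))

sum-punchIn : ∀ k (f : Fin (suc k) → ℚ) j → sumFin (suc k) f ≡ f j + sumFin k (f ∘ punchIn j)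
sum-punchIn k       f zero    = refl
sum-punchIn (suc k) f (suc j) = trans (cong (f zero +_) (sum-punchIn k (f ∘ suc) j))
  (x+[y+z]≡y+[x+z] (f zero) (f (suc j)) _)

sum-single : ∀ k (f : Fin k → ℚ) i → (∀ j → j ≢ i → f j ≡ 0ℚ) → sumFin k f ≡ f i
sum-single (suc k) f i f≡0 = begin
  sumFin (suc k) f                  ≡⟨ sum-punchIn k f i ⟩
  f i + sumFin k (f ∘ punchIn i)    ≡⟨ cong (f i +_) (sum-zero k (λ j → f≡0 _ (Fin.punchInᵢ≢i i j))) ⟩
  f i + 0ℚ                          ≡⟨ ℚ.+-identityʳ (f i) ⟩
  f i                               ∎
  where open ≡-Reasoning

sum-↑ : ∀ a b (f : Fin (a ℕ.+ b) → ℚ) →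
  sumFin (a ℕ.+ b) f ≡ sumFin a (λ i → f (i ↑ˡ b)) + sumFin b (λ j → f (a ↑ʳ j))
sum-↑ zero    b f = sym (ℚ.+-identityˡ _)
sum-↑ (suc a) b f = trans (cong (f zero +_) (sum-↑ a b (f ∘ suc))) (sym (ℚ.+-assoc (f zero) _ _))

sum-mono : ∀ k {f g : Fin k → ℚ} → (∀ i → f i ≤ℚ g i) → sumFin k f ≤ℚ sumFin k g
sum-mono zero    f≤g = ℚ.≤-refl
sum-mono (suc k) f≤g = ℚ.+-mono-≤ (f≤g zero) (sum-mono k (f≤g ∘ suc))

sum-nonneg : ∀ k {f : Fin k → ℚ} → (∀ i → 0ℚ ≤ℚ f i) → 0ℚ ≤ℚ sumFin k f
sum-nonneg k {f} 0≤f = subst (_≤ℚ sumFin k f) (sum-zero k {λ _ → 0ℚ} (λ _ → refl)) (sum-mono k 0≤f)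

term≤sum : ∀ k (f : Fin k → ℚ) i → (∀ j → 0ℚ ≤ℚ f j) → f i ≤ℚ sumFin k f
term≤sum (suc k) f i 0≤f = begin
  f i                            ≡⟨ ℚ.+-identityʳ (f i) ⟨
  f i + 0ℚ                       ≤⟨ ℚ.+-monoʳ-≤ (f i) (sum-nonneg k (0≤f ∘ punchIn i)) ⟩
  f i + sumFin k (f ∘ punchIn i) ≡⟨ sum-punchIn k f i ⟨
  sumFin (suc k) f               ∎
  where open ℚ.≤-Reasoning

sum-ones : ∀ k → sumFin k (λ _ → 1ℚ) ≡ ℕtoℚ k
sum-ones zero    = refl
sum-ones (suc k) = trans (cong (1ℚ +_) (sum-ones k)) (sym (ℕtoℚ-suc k))

sum⊎ : ∀ n m → (Fin n ⊎ Fin m → ℚ) → ℚ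
sum⊎ n m g = sumFin n (g ∘ inj₁) + sumFin m (g ∘ inj₂)

module _ {n m : ℕ} where

  sum⊎-cong : {f g : Fin n ⊎ Fin m → ℚ} → (∀ a → f a ≡ g a) → sum⊎ n m f ≡ sum⊎ n m g
  sum⊎-cong f≗g = cong₂ _+_ (sum-cong n (f≗g ∘ inj₁)) (sum-cong m (f≗g ∘ inj₂))

  sum⊎-zero : {f : Fin n ⊎ Fin m → ℚ} → (∀ a → f a ≡ 0ℚ) → sum⊎ n m f ≡ 0ℚ
  sum⊎-zero f≗0 = cong₂ _+_ (sum-zero n (f≗0 ∘ inj₁)) (sum-zero m (f≗0 ∘ inj₂))

  sum⊎-+ : (f g : Fin n ⊎ Fin m → ℚ) → sum⊎ n m (λ a → f a + g a) ≡ sum⊎ n m f + sum⊎ n m g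
  sum⊎-+ f g = trans (cong₂ _+_ (sum-+ n (f ∘ inj₁) (g ∘ inj₁)) (sum-+ m (f ∘ inj₂) (g ∘ inj₂)))
    (+-interchange (sumFin n (f ∘ inj₁)) _ (sumFin m (f ∘ inj₂)) _)

  sum⊎-*ˡ : ∀ x (f : Fin n ⊎ Fin m → ℚ) → sum⊎ n m (λ a → x * f a) ≡ x * sum⊎ n m f
  sum⊎-*ˡ x f = trans (cong₂ _+_ (sum-*ˡ n x _) (sum-*ˡ m x _)) (sym (ℚ.*-distribˡ-+ x _ _))

  sum⊎-neg : (f : Fin n ⊎ Fin m → ℚ) → sum⊎ n m (λ a → - f a) ≡ - sum⊎ n m f
  sum⊎-neg f = trans (cong₂ _+_ (sum-neg n (f ∘ inj₁)) (sum-neg m (f ∘ inj₂)))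
    (sym (ℚ.neg-distrib-+ (sumFin n (f ∘ inj₁)) (sumFin m (f ∘ inj₂))))

  sum⊎-swap : ∀ k (f : Fin k → Fin n ⊎ Fin m → ℚ) →
    sum⊎ n m (λ a → sumFin k (λ i → f i a)) ≡ sumFin k (λ i → sum⊎ n m (f i))
  sum⊎-swap k f = trans (cong₂ _+_ (sum-swap n k (λ j i → f i (inj₁ j))) (sum-swap m k (λ j i → f i (inj₂ j))))
    (sym (sum-+ k _ _))

  sum⊎-single : (f : Fin n ⊎ Fin m → ℚ) (a : Fin n ⊎ Fin m) → (∀ b → b ≢ a → f b ≡ 0ℚ) → sum⊎ n m f ≡ f a
  sum⊎-single f (inj₁ i) f≡0 = trans
    (cong₂ _+_ (sum-single n _ i (λ j j≢i → f≡0 (inj₁ j) (j≢i ∘ inj₁-injective)))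
               (sum-zero m (λ j → f≡0 (inj₂ j) λ ())))
    (ℚ.+-identityʳ _)
  sum⊎-single f (inj₂ i) f≡0 = trans
    (cong₂ _+_ (sum-zero n (λ j → f≡0 (inj₁ j) λ ()))
               (sum-single m _ i (λ j j≢i → f≡0 (inj₂ j) (j≢i ∘ inj₂-injective))))
    (ℚ.+-identityˡ _)

  term≤sum⊎ : (f : Fin n ⊎ Fin m → ℚ) (a : Fin n ⊎ Fin m) → (∀ b → 0ℚ ≤ℚ f b) → f a ≤ℚ sum⊎ n m f
  term≤sum⊎ f (inj₁ i) 0≤f = subst (_≤ℚ sum⊎ n m f) (ℚ.+-identityʳ (f (inj₁ i)))
    (ℚ.+-mono-≤ (term≤sum n _ i (0≤f ∘ inj₁)) (sum-nonneg m (0≤f ∘ inj₂)))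
  term≤sum⊎ f (inj₂ i) 0≤f = subst (_≤ℚ sum⊎ n m f) (ℚ.+-identityˡ (f (inj₂ i)))
    (ℚ.+-mono-≤ (sum-nonneg n (0≤f ∘ inj₁)) (term≤sum m _ i (0≤f ∘ inj₂)))

LinIndep : ∀ k (X : Set) → (Fin k → X → ℚ) → Set
LinIndep k X v = ∀ (μ : Fin k → ℚ) → (∀ a → sumFin k (λ i → μ i * v i a) ≡ 0ℚ) → ∀ i → μ i ≡ 0ℚ

linIndep-tail : ∀ {k N} (v : Fin k → Fin (suc N) → ℚ) → (∀ i → v i zero ≡ 0ℚ) →
  LinIndep k (Fin (suc N)) v → LinIndep k (Fin N) (λ i c → v i (suc c))
linIndep-tail {k} v v₀≡0 indep μ μv≡0 = indep μ λ where
  zero    → sum-zero k (λ i → trans (cong (μ i *_) (v₀≡0 i)) (ℚ.*-zeroʳ (μ i)))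
  (suc c) → μv≡0 c

-- One step of Gaussian elimination: the pivot vector v j clears the first coordinate of the others.
linIndep-pivot : ∀ {k N} (v : Fin (suc k) → Fin (suc N) → ℚ) j → v j zero ≢ 0ℚ →
  LinIndep (suc k) (Fin (suc N)) v →
  LinIndep k (Fin N) (λ i c → v j zero * v (punchIn j i) (suc c) - v (punchIn j i) zero * v j (suc c))
linIndep-pivot {k} v j p≢0 indep μ μu≡0 i =
  p≢0∧p*q≡0⇒q≡0 p (μ i) p≢0 (trans (sym (insertAt-punchIn pμ j S i)) (indep ν νv≡0 (punchIn j i)))
  where
  p = v j zero
  w : Fin k → ℚ
  w i = v (punchIn j i) zero
  pμ : Fin k → ℚ
  pμ i = p * μ i
  S = - sumFin k (λ i → μ i * w i)
  ν = insertAt pμ j S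
  combination : ∀ (y : Fin (suc k) → ℚ) →
    sumFin (suc k) (λ x → ν x * y x) ≡ sumFin k (λ i → μ i * (p * y (punchIn j i) - w i * y j))
  combination y = begin
    sumFin (suc k) (λ x → ν x * y x)
      ≡⟨ sum-punchIn k (λ x → ν x * y x) j ⟩
    ν j * y j + sumFin k (λ i → ν (punchIn j i) * y (punchIn j i))
      ≡⟨ cong₂ (λ a b → a * y j + b) (insertAt-lookup pμ j S)
               (sum-cong k (λ i → cong (_* y (punchIn j i)) (insertAt-punchIn pμ j S i))) ⟩
    S * y j + sumFin k (λ i → pμ i * y (punchIn j i))
      ≡⟨ cong (_+ sumFin k (λ i → pμ i * y (punchIn j i))) (trans (sum-*ʳ k (y j) _) (cong (_* y j) (sum-neg k _))) ⟨
    sumFin k (λ i → - (μ i * w i) * y j) + sumFin k (λ i → pμ i * y (punchIn j i))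
      ≡⟨ sum-+ k _ _ ⟨
    sumFin k (λ i → - (μ i * w i) * y j + pμ i * y (punchIn j i))
      ≡⟨ sum-cong k (λ i → solve 5 (λ m w a b p → (:- (m :* w)) :* a :+ (p :* m) :* b := m :* (p :* b :- w :* a))
                                   refl (μ i) (w i) (y j) (y (punchIn j i)) p) ⟩
    sumFin k (λ i → μ i * (p * y (punchIn j i) - w i * y j))
      ∎
    where open ≡-Reasoning
  νv≡0 : ∀ c → sumFin (suc k) (λ x → ν x * v x c) ≡ 0ℚ
  νv≡0 zero    = trans (combination (λ x → v x zero))
    (sum-zero k (λ i → trans (cong (μ i *_) (trans (cong (_- w i * p) (ℚ.*-comm p (w i))) (ℚ.+-inverseʳ (w i * p))))
                             (ℚ.*-zeroʳ (μ i))))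
  νv≡0 (suc c) = trans (combination (λ x → v x (suc c))) (μu≡0 c)

linIndep-bound : ∀ N k (v : Fin k → Fin N → ℚ) → LinIndep k (Fin N) v → k ≤ N
linIndep-bound N       zero    v indep = z≤n
linIndep-bound zero    (suc k) v indep with () ← indep (λ _ → 1ℚ) (λ ()) zero
linIndep-bound (suc N) (suc k) v indep with Fin.any? (λ j → ¬? (v j zero ℚ.≟ 0ℚ))
... | yes (j , pivot) = s≤s (linIndep-bound N k _ (linIndep-pivot v j pivot indep))
... | no noPivot      = ℕ.m≤n⇒m≤1+n (linIndep-bound N (suc k) (λ i c → v i (suc c)) (linIndep-tail v column₀≡0 indep))
  where
  column₀≡0 : ∀ j → v j zero ≡ 0ℚ
  column₀≡0 j = decidable-stable (v j zero ℚ.≟ 0ℚ) (λ v≢0 → noPivot (j , v≢0))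

linIndep-∘ : ∀ {k X Y} (v : Fin k → X → ℚ) (t : Y → X) (s : X → Y) → (∀ x → t (s x) ≡ x) →
  LinIndep k X v → LinIndep k Y (λ i → v i ∘ t)
linIndep-∘ {k} v t s ts≗id indep μ μv≡0 =
  indep μ (λ x → subst (λ z → sumFin k (λ i → μ i * v i z) ≡ 0ℚ) (ts≗id x) (μv≡0 (s x)))

linIndep-⊎-bound : ∀ n m k (v : Fin k → Fin n ⊎ Fin m → ℚ) → LinIndep k (Fin n ⊎ Fin m) v → k ≤ n ℕ.+ m
linIndep-⊎-bound n m k v indep =
  linIndep-bound (n ℕ.+ m) k _ (linIndep-∘ v (splitAt n) (join n m) (Fin.splitAt-join n m) indep)

linIndep⇒affIndep : ∀ {d X} (p : Fin (suc d) → X → ℚ) → LinIndep (suc d) X p →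
  LinIndep d X (λ i a → p (suc i) a - p zero a)
linIndep⇒affIndep {d} p indep μ μΔp≡0 i = indep ν νp≡0 (suc i)
  where
  ν : Fin (suc d) → ℚ
  ν zero    = - sumFin d μ
  ν (suc i) = μ i
  νp≡0 : ∀ a → sumFin (suc d) (λ x → ν x * p x a) ≡ 0ℚ
  νp≡0 a = begin
    - sumFin d μ * p zero a + sumFin d (λ i → μ i * p (suc i) a)
      ≡⟨ cong (_+ sumFin d (λ i → μ i * p (suc i) a)) (trans (sum-*ʳ d (p zero a) _) (cong (_* p zero a) (sum-neg d μ))) ⟨
    sumFin d (λ i → - μ i * p zero a) + sumFin d (λ i → μ i * p (suc i) a)
      ≡⟨ sum-+ d _ _ ⟨
    sumFin d (λ i → - μ i * p zero a + μ i * p (suc i) a)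
      ≡⟨ sum-cong d (λ i → solve 3 (λ m x y → (:- m) :* x :+ m :* y := m :* (y :- x)) refl (μ i) (p zero a) _) ⟩
    sumFin d (λ i → μ i * (p (suc i) a - p zero a))
      ≡⟨ μΔp≡0 a ⟩
    0ℚ ∎
    where open ≡-Reasoning

-- The total matching polytope of an arbitrary graph

module _ (G : Graph) where
  open Graph G

  _≟ᴱ_ : (a b : Elt G) → Dec (a ≡ b)
  _≟ᴱ_ = ≡-dec Fin._≟_ Fin._≟_

  Joins-sym : ∀ {u v ε} → Joins G u v ε → Joins G v u ε
  Joins-sym = ⊎.swap

  Joins-unique : ∀ {u v ε ε′} → Joins G u v ε → Joins G u v ε′ → ε ≡ ε′
  Joins-unique (inj₁ (refl , refl)) (inj₁ (s′ , t′)) = simple _ _ (inj₁ (sym s′ , sym t′))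
  Joins-unique (inj₁ (refl , refl)) (inj₂ (s′ , t′)) = simple _ _ (inj₂ (sym t′ , sym s′))
  Joins-unique (inj₂ (refl , refl)) (inj₁ (s′ , t′)) = simple _ _ (inj₂ (sym t′ , sym s′))
  Joins-unique (inj₂ (refl , refl)) (inj₂ (s′ , t′)) = simple _ _ (inj₁ (sym s′ , sym t′))

  Endpoint? : ∀ v ε → Dec (Endpoint G v ε)
  Endpoint? v ε = (src ε Fin.≟ v) ⊎-dec (tgt ε Fin.≟ v)

  dot-comb : ∀ k (μ : Fin k → ℚ) (q : Fin k → Pt G) (c : Pt G) →
    dot G c (λ a → sumFin k (λ i → μ i * q i a)) ≡ sumFin k (λ i → μ i * dot G c (q i))
  dot-comb k μ q c = begin
    sum⊎ n m (λ a → c a * sumFin k (λ i → μ i * q i a))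
      ≡⟨ sum⊎-cong (λ a → trans (sym (sum-*ˡ k (c a) _))
           (sum-cong k (λ i → solve 3 (λ c μ q → c :* (μ :* q) := μ :* (c :* q)) refl (c a) (μ i) (q i a)))) ⟩
    sum⊎ n m (λ a → sumFin k (λ i → μ i * (c a * q i a)))
      ≡⟨ sum⊎-swap k (λ i a → μ i * (c a * q i a)) ⟩
    sumFin k (λ i → sum⊎ n m (λ a → μ i * (c a * q i a)))
      ≡⟨ sum-cong k (λ i → sum⊎-*ˡ (μ i) (λ a → c a * q i a)) ⟩
    sumFin k (λ i → μ i * dot G c (q i))
      ∎
    where open ≡-Reasoning

  dot-difference : ∀ (c x y : Pt G) → dot G c (λ a → x a - y a) ≡ dot G c x - dot G c y
  dot-difference c x y = begin
    sum⊎ n m (λ a → c a * (x a - y a))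
      ≡⟨ sum⊎-cong (λ a → trans (ℚ.*-distribˡ-+ (c a) (x a) (- y a))
                                (cong (c a * x a +_) (sym (ℚ.neg-distribʳ-* (c a) (y a))))) ⟩
    sum⊎ n m (λ a → c a * x a + - (c a * y a))
      ≡⟨ sum⊎-+ (λ a → c a * x a) (λ a → - (c a * y a)) ⟩
    dot G c x + sum⊎ n m (λ a → - (c a * y a))
      ≡⟨ cong (dot G c x +_) (sum⊎-neg (λ a → c a * y a)) ⟩
    dot G c x - dot G c y
      ∎
    where open ≡-Reasoning

  χ-InPT : ∀ T → TotalMatching G T → InPT G (χ G T)
  χ-InPT T T-matching =
    1 , (λ _ → T) , (λ _ → 1ℚ) , (λ _ → T-matching) , (λ _ → ℚ.nonNegative⁻¹ 1ℚ) , ℚ.+-identityʳ 1ℚ ,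
    (λ a → sym (trans (ℚ.+-identityʳ _) (ℚ.*-identityˡ _)))

  valid-of-matchings : ∀ (c : Pt G) β → (∀ T → TotalMatching G T → dot G c (χ G T) ≤ℚ β) → ValidIneq G c β
  valid-of-matchings c β cχ≤β x (k , T , w , T-matching , 0≤w , ∑w≡1 , x≡∑wχ) = begin
    dot G c x                              ≡⟨ sum⊎-cong (λ a → cong (c a *_) (x≡∑wχ a)) ⟩
    dot G c (λ a → sumFin k (λ i → w i * χ G (T i) a))
                                           ≡⟨ dot-comb k w (χ G ∘ T) c ⟩
    sumFin k (λ i → w i * dot G c (χ G (T i)))
                                           ≤⟨ sum-mono k (λ i → ℚ.*-monoˡ-≤-nonNeg (w i) {{nonNegative (0≤w i)}}
                                                                 (cχ≤β (T i) (T-matching i))) ⟩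
    sumFin k (λ i → w i * β)               ≡⟨ sum-*ʳ k β w ⟩
    sumFin k w * β                         ≡⟨ cong (_* β) ∑w≡1 ⟩
    1ℚ * β                                 ≡⟨ ℚ.*-identityˡ β ⟩
    β                                      ∎
    where open ℚ.≤-Reasoning

  -- c together with the differences p (suc i) - p zero is independent, since c is orthogonal to them
  hyperplane-affIndep-bound : ∀ (c : Pt G) β k (p : Fin (suc k) → Pt G) → (∀ i → dot G c (p i) ≡ β) →
    dot G c c ≢ 0ℚ → AffIndep G k p → suc k ≤ n ℕ.+ m
  hyperplane-affIndep-bound c β k p cp≡β cc≢0 affIndep = linIndep-⊎-bound n m (suc k) v v-indep
    where
    v : Fin (suc k) → Pt G
    v zero    = c
    v (suc i) a = p (suc i) a - p zero a
    v-indep : LinIndep (suc k) (Elt G) v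
    v-indep μ μv≡0 = μ≡0
      where
      R : Pt G
      R a = sumFin k (λ i → μ (suc i) * v (suc i) a)
      μcv≡0 : sumFin k (λ i → μ (suc i) * dot G c (v (suc i))) ≡ 0ℚ
      μcv≡0 = sum-zero k (λ i → begin
        μ (suc i) * dot G c (v (suc i))           ≡⟨ cong (μ (suc i) *_) (dot-difference c (p (suc i)) (p zero)) ⟩
        μ (suc i) * (dot G c (p (suc i)) - dot G c (p zero))
                                                  ≡⟨ cong₂ (λ x y → μ (suc i) * (x - y)) (cp≡β (suc i)) (cp≡β zero) ⟩
        μ (suc i) * (β - β)                       ≡⟨ cong (μ (suc i) *_) (ℚ.+-inverseʳ β) ⟩
        μ (suc i) * 0ℚ                            ≡⟨ ℚ.*-zeroʳ (μ (suc i)) ⟩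
        0ℚ                                        ∎)
        where open ≡-Reasoning
      μ₀≡0 : μ zero ≡ 0ℚ
      μ₀≡0 = p≢0∧p*q≡0⇒q≡0 (dot G c c) (μ zero) cc≢0 (begin
        dot G c c * μ zero                        ≡⟨ ℚ.*-comm (dot G c c) (μ zero) ⟩
        μ zero * dot G c c                        ≡⟨ ℚ.+-identityʳ _ ⟨
        μ zero * dot G c c + 0ℚ                   ≡⟨ cong (μ zero * dot G c c +_) μcv≡0 ⟨
        sumFin (suc k) (λ i → μ i * dot G c (v i)) ≡⟨ dot-comb (suc k) μ v c ⟨
        dot G c (λ a → sumFin (suc k) (λ i → μ i * v i a))
                                                  ≡⟨ sum⊎-zero (λ a → trans (cong (c a *_) (μv≡0 a)) (ℚ.*-zeroʳ (c a))) ⟩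
        0ℚ                                        ∎)
        where open ≡-Reasoning
      μ≡0 : ∀ i → μ i ≡ 0ℚ
      μ≡0 zero    = μ₀≡0
      μ≡0 (suc i) = affIndep (μ ∘ suc) (λ a → begin
        R a                          ≡⟨ ℚ.+-identityˡ (R a) ⟨
        0ℚ + R a                     ≡⟨ cong (_+ R a) (trans (sym (ℚ.*-zeroˡ (c a))) (cong (_* c a) (sym μ₀≡0))) ⟩
        μ zero * c a + R a           ≡⟨ μv≡0 a ⟩
        0ℚ                           ∎) i
        where open ≡-Reasoning

  singleton : Elt G → Elt G → Bool
  singleton x b = does (x ≟ᴱ b)

  singleton-matching : ∀ x → TotalMatching G (singleton x)
  singleton-matching x a b x≡a x≡b a≢b _ = a≢b (trans (sym (does-sound (x ≟ᴱ a) x≡a)) (does-sound (x ≟ᴱ b) x≡b))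

  χ-singleton-≢ : ∀ {x y} → x ≢ y → χ G (singleton x) y ≡ 0ℚ
  χ-singleton-≢ {x} {y} x≢y = cong (if_then 1ℚ else 0ℚ) (dec-false (x ≟ᴱ y) x≢y)

  χ-singleton-self : ∀ x → χ G (singleton x) x ≡ 1ℚ
  χ-singleton-self x = cong (if_then 1ℚ else 0ℚ) (dec-true (x ≟ᴱ x) refl)

  sum-point-mass : ∀ y x → sum⊎ n m (λ a → y * χ G (singleton x) a) ≡ y
  sum-point-mass y x = begin
    sum⊎ n m (λ a → y * χ G (singleton x) a)  ≡⟨ sum⊎-*ˡ y (χ G (singleton x)) ⟩
    y * sum⊎ n m (χ G (singleton x))          ≡⟨ cong (y *_) (sum⊎-single _ x (λ a a≢x → χ-singleton-≢ (a≢x ∘ sym))) ⟩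
    y * χ G (singleton x) x                   ≡⟨ cong (y *_) (χ-singleton-self x) ⟩
    y * 1ℚ                                    ≡⟨ ℚ.*-identityʳ y ⟩
    y                                         ∎
    where open ≡-Reasoning

  empty-matching : TotalMatching G (λ _ → false)
  empty-matching a b ()

  -- The empty set and the singletons give n + m + 1 affinely independent points.
  PT-dim : HasDim G (InPT G) (n ℕ.+ m)
  PT-dim = (p , p-InPT , p-affIndep) , no-larger
    where
    N = n ℕ.+ m
    p : Fin (suc N) → Pt G
    p zero    = χ G (λ _ → false)
    p (suc k) = χ G (singleton (splitAt n k))
    p-InPT : ∀ i → InPT G (p i)
    p-InPT zero    = χ-InPT _ empty-matching
    p-InPT (suc k) = χ-InPT _ (singleton-matching (splitAt n k))
    splitAt-injective : ∀ {k l} → splitAt n k ≡ splitAt n l → k ≡ l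
    splitAt-injective {k} {l} eq =
      trans (sym (Fin.join-splitAt n m k)) (trans (cong (join n m) eq) (Fin.join-splitAt n m l))
    p-affIndep : AffIndep G N p
    p-affIndep μ μp≡0 i = trans μ-at-i (trans (sym (sum-single N _ i μ-off-i)) (μp≡0 (splitAt n i)))
      where
      μ-off-i : ∀ k → k ≢ i → μ k * (p (suc k) (splitAt n i) - 0ℚ) ≡ 0ℚ
      μ-off-i k k≢i = trans (cong (λ z → μ k * (z - 0ℚ)) (χ-singleton-≢ (k≢i ∘ splitAt-injective)))
                            (ℚ.*-zeroʳ (μ k))
      μ-at-i : μ i ≡ μ i * (p (suc i) (splitAt n i) - 0ℚ)
      μ-at-i = sym (trans (cong (λ z → μ i * (z - 0ℚ)) (χ-singleton-self (splitAt n i))) (ℚ.*-identityʳ (μ i)))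
    no-larger : ∀ q → (∀ i → InPT G (q i)) → ¬ AffIndep G (suc N) q
    no-larger q _ affIndep = ℕ.<-irrefl refl (linIndep-⊎-bound n m (suc N) (λ i a → q (suc i) a - q zero a) affIndep)

  facet-of-independent-matchings : ∀ (c : Pt G) β d → n ℕ.+ m ≡ suc d → ValidIneq G c β →
    dot G c c ≢ 0ℚ → (T : Fin (suc d) → Elt G → Bool) → (∀ i → TotalMatching G (T i)) →
    (∀ i → dot G c (χ G (T i)) ≡ β) → LinIndep (suc d) (Elt G) (χ G ∘ T) → IsFacet G c β
  facet-of-independent-matchings c β d N≡1+d valid cc≢0 T T-matching cT≡β T-indep =
    valid , d , subst (HasDim G (InPT G)) N≡1+d PT-dim ,
    ((χ G ∘ T , (λ i → χ-InPT (T i) (T-matching i) , cT≡β i) , linIndep⇒affIndep (χ G ∘ T) T-indep) ,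
     no-larger)
    where
    no-larger : ∀ p → (∀ i → Face G c β (p i)) → ¬ AffIndep G (suc d) p
    no-larger p p-face affIndep = ℕ.<-irrefl refl (subst (suc (suc d) ≤_) N≡1+d
      (hyperplane-affIndep-bound c β (suc d) p (proj₂ ∘ p-face) cc≢0 affIndep))

-- Total matchings of the complete bipartite graph K_{r,r}

data Pos (r : ℕ) : Set where
  left right : Fin r → Pos r
  edge       : Fin r → Fin r → Pos r

data Adjᴷ {r} : Pos r → Pos r → Set where
  left-right  : ∀ i j → Adjᴷ (left i) (right j)
  right-left  : ∀ i j → Adjᴷ (right j) (left i)
  left-edge   : ∀ i j → Adjᴷ (left i) (edge i j)
  edge-left   : ∀ i j → Adjᴷ (edge i j) (left i)
  right-edge  : ∀ i j → Adjᴷ (right j) (edge i j)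
  edge-right  : ∀ i j → Adjᴷ (edge i j) (right j)
  edge-edgeˡ  : ∀ i j l → j ≢ l → Adjᴷ (edge i j) (edge i l)
  edge-edgeʳ  : ∀ i k j → i ≢ k → Adjᴷ (edge i j) (edge k j)

Independentᴷ : ∀ {r} → (Pos r → Bool) → Set
Independentᴷ S = ∀ x y → S x ≡ true → S y ≡ true → ¬ Adjᴷ x y

Adjᴷ-irreflexive : ∀ {r} {x : Pos r} → ¬ Adjᴷ x x
Adjᴷ-irreflexive (edge-edgeˡ i j .j j≢j) = j≢j refl
Adjᴷ-irreflexive (edge-edgeʳ i .i j i≢i) = i≢i refl

sumᴷ : ∀ r → (Pos r → ℚ) → ℚ
sumᴷ r g = sumFin r (g ∘ left) + sumFin r (g ∘ right) + sumFin r (λ i → sumFin r (g ∘ edge i))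

module _ {r : ℕ} where

  sumᴷ-cong : {g h : Pos r → ℚ} → (∀ x → g x ≡ h x) → sumᴷ r g ≡ sumᴷ r h
  sumᴷ-cong g≗h = cong₂ _+_ (cong₂ _+_ (sum-cong r (g≗h ∘ left)) (sum-cong r (g≗h ∘ right)))
                            (sum-cong r (λ i → sum-cong r (g≗h ∘ edge i)))

  sumᴷ-zero : {g : Pos r → ℚ} → (∀ x → g x ≡ 0ℚ) → sumᴷ r g ≡ 0ℚ
  sumᴷ-zero g≗0 = trans (sumᴷ-cong g≗0) (cong₂ _+_ (cong₂ _+_ zeros zeros) (sum-zero r (λ _ → zeros)))
    where
    zeros : sumFin r (λ _ → 0ℚ) ≡ 0ℚ
    zeros = sum-zero r (λ _ → refl)

  sumᴷ-single : (h : Pos r → ℚ) (y : Pos r) → (∀ x → x ≢ y → h x ≡ 0ℚ) → sumᴷ r h ≡ h y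
  sumᴷ-single h (left i) h≡0 = trans
    (cong₂ _+_ (cong₂ _+_ (sum-single r _ i (λ k k≢i → h≡0 (left k) (k≢i ∘ left-injective)))
                          (sum-zero r (λ l → h≡0 (right l) λ ())))
               (sum-zero r (λ k → sum-zero r (λ l → h≡0 (edge k l) λ ()))))
    (trans (ℚ.+-identityʳ _) (ℚ.+-identityʳ _))
    where
    left-injective : ∀ {k i} → left {r} k ≡ left i → k ≡ i
    left-injective refl = refl
  sumᴷ-single h (right j) h≡0 = trans
    (cong₂ _+_ (cong₂ _+_ (sum-zero r (λ k → h≡0 (left k) λ ()))
                          (sum-single r _ j (λ l l≢j → h≡0 (right l) (l≢j ∘ right-injective))))
               (sum-zero r (λ k → sum-zero r (λ l → h≡0 (edge k l) λ ()))))
    (trans (ℚ.+-identityʳ _) (ℚ.+-identityˡ _))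
    where
    right-injective : ∀ {l j} → right {r} l ≡ right j → l ≡ j
    right-injective refl = refl
  sumᴷ-single h (edge i j) h≡0 = trans
    (cong₂ _+_ (cong₂ _+_ (sum-zero r (λ k → h≡0 (left k) λ ())) (sum-zero r (λ l → h≡0 (right l) λ ())))
               (trans (sum-single r _ i other-row)
                      (sum-single r _ j (λ l l≢j → h≡0 (edge i l) (l≢j ∘ proj₂ ∘ edge-injective)))))
    (ℚ.+-identityˡ _)
    where
    edge-injective : ∀ {k l i j} → edge {r} k l ≡ edge i j → k ≡ i × l ≡ j
    edge-injective refl = refl , refl
    other-row : ∀ k → k ≢ i → sumFin r (h ∘ edge k) ≡ 0ℚ
    other-row k k≢i = sum-zero r (λ l → h≡0 (edge k l) (k≢i ∘ proj₁ ∘ edge-injective))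

  sum⊎-sumᴷ : ∀ n m (F : Pos r → Fin n ⊎ Fin m → ℚ) →
    sum⊎ n m (λ a → sumᴷ r (λ x → F x a)) ≡ sumᴷ r (λ x → sum⊎ n m (F x))
  sum⊎-sumᴷ n m F = begin
    sum⊎ n m (λ a → (FL a + FR a) + FE a)
      ≡⟨ trans (sum⊎-+ (λ a → FL a + FR a) FE) (cong (_+ sum⊎ n m FE) (sum⊎-+ FL FR)) ⟩
    (sum⊎ n m FL + sum⊎ n m FR) + sum⊎ n m FE
      ≡⟨ cong₂ _+_ (cong₂ _+_ (sum⊎-swap r (F ∘ left)) (sum⊎-swap r (F ∘ right)))
                   (trans (sum⊎-swap r (λ i a → sumFin r (λ j → F (edge i j) a)))
                          (sum-cong r (λ i → sum⊎-swap r (F ∘ edge i)))) ⟩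
    sumᴷ r (λ x → sum⊎ n m (F x))
      ∎
    where
    open ≡-Reasoning
    FL FR FE : Fin n ⊎ Fin m → ℚ
    FL a = sumFin r (λ i → F (left i) a)
    FR a = sumFin r (λ j → F (right j) a)
    FE a = sumFin r (λ i → sumFin r (λ j → F (edge i j) a))

-- χ G T a unfolds to ind (T a).
ind : Bool → ℚ
ind b = if b then 1ℚ else 0ℚ

sum-ind-≤1 : ∀ k (b : Fin k → Bool) → (∀ j l → j ≢ l → b j ≡ true → b l ≡ true → ⊥) →
  sumFin k (ind ∘ b) ≤ℚ 1ℚ
sum-ind-≤1 zero    b clique = ℚ.nonNegative⁻¹ 1ℚ
sum-ind-≤1 (suc k) b clique with b zero in b₀
... | true  = ℚ.≤-reflexive (trans (cong (1ℚ +_) (sum-zero k (cong ind ∘ rest-false))) (ℚ.+-identityʳ 1ℚ))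
  where
  rest-false : ∀ j → b (suc j) ≡ false
  rest-false j with b (suc j) in bⱼ
  ... | true  = ⊥-elim (clique zero (suc j) (λ ()) b₀ bⱼ)
  ... | false = refl
... | false = subst (_≤ℚ 1ℚ) (sym (ℚ.+-identityˡ _))
  (sum-ind-≤1 k (b ∘ suc) (λ j l j≢l → clique (suc j) (suc l) (j≢l ∘ Fin.suc-injective)))

row column : ∀ {r} → Fin r → Fin (suc r) → Pos r
row    i zero    = left i
row    i (suc j) = edge i j
column j zero    = right j
column j (suc i) = edge i j

row-clique : ∀ {r} (i : Fin r) x y → x ≢ y → Adjᴷ (row i x) (row i y)
row-clique i zero    zero    x≢y = ⊥-elim (x≢y refl)
row-clique i zero    (suc l) _   = left-edge i l
row-clique i (suc j) zero    _   = edge-left i j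
row-clique i (suc j) (suc l) x≢y = edge-edgeˡ i j l (x≢y ∘ cong suc)

column-clique : ∀ {r} (j : Fin r) x y → x ≢ y → Adjᴷ (column j x) (column j y)
column-clique j zero    zero    x≢y = ⊥-elim (x≢y refl)
column-clique j zero    (suc k) _   = right-edge k j
column-clique j (suc i) zero    _   = edge-right i j
column-clique j (suc i) (suc k) x≢y = edge-edgeʳ i k j (x≢y ∘ cong suc)

module _ {r : ℕ} (S : Pos r → Bool) (S-indep : Independentᴷ S) where

  lines-≤ : (line : Fin r → Fin (suc r) → Pos r) → (∀ i x y → x ≢ y → Adjᴷ (line i x) (line i y)) →
    sumFin r (λ i → sumFin (suc r) (ind ∘ S ∘ line i)) ≤ℚ ℕtoℚ r
  lines-≤ line clique = begin
    sumFin r (λ i → sumFin (suc r) (ind ∘ S ∘ line i))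
      ≤⟨ sum-mono r (λ i → sum-ind-≤1 (suc r) (S ∘ line i)
                             (λ x y x≢y Sx Sy → S-indep _ _ Sx Sy (clique i x y x≢y))) ⟩
    sumFin r (λ _ → 1ℚ)  ≡⟨ sum-ones r ⟩
    ℕtoℚ r               ∎
    where open ℚ.≤-Reasoning

  -- A total matching of K_{r,r} avoids one side entirely, and then meets each row (or each column) at most once.
  independentᴷ-size : sumᴷ r (ind ∘ S) ≤ℚ ℕtoℚ r
  independentᴷ-size with Fin.any? (λ j → S (right j) Bool.≟ true)
  ... | no no-right = begin
    (ΣL + ΣR) + ΣE    ≡⟨ cong (λ z → (ΣL + z) + ΣE) (sum-zero r (λ j → cong ind (¬-not (no-right ∘ (j ,_))))) ⟩
    (ΣL + 0ℚ) + ΣE    ≡⟨ cong (_+ ΣE) (ℚ.+-identityʳ ΣL) ⟩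
    ΣL + ΣE           ≡⟨ sum-+ r _ _ ⟨
    sumFin r (λ i → sumFin (suc r) (ind ∘ S ∘ row i))
                      ≤⟨ lines-≤ row row-clique ⟩
    ℕtoℚ r            ∎
    where
    open ℚ.≤-Reasoning
    ΣL = sumFin r (ind ∘ S ∘ left)
    ΣR = sumFin r (ind ∘ S ∘ right)
    ΣE = sumFin r (λ i → sumFin r (ind ∘ S ∘ edge i))
  ... | yes (j₀ , Sj₀) = begin
    (ΣL + ΣR) + ΣE    ≡⟨ cong (λ z → (z + ΣR) + ΣE)
                              (sum-zero r (λ i → cong ind (¬-not λ Si → S-indep _ _ Si Sj₀ (left-right i j₀)))) ⟩
    (0ℚ + ΣR) + ΣE    ≡⟨ cong₂ _+_ (ℚ.+-identityˡ ΣR) (sum-swap r r (λ i j → ind (S (edge i j)))) ⟩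
    ΣR + sumFin r (λ j → sumFin r (λ i → ind (S (edge i j))))
                      ≡⟨ sum-+ r _ _ ⟨
    sumFin r (λ j → sumFin (suc r) (ind ∘ S ∘ column j))
                      ≤⟨ lines-≤ column column-clique ⟩
    ℕtoℚ r            ∎
    where
    open ℚ.≤-Reasoning
    ΣL = sumFin r (ind ∘ S ∘ left)
    ΣR = sumFin r (ind ∘ S ∘ right)
    ΣE = sumFin r (λ i → sumFin r (ind ∘ S ∘ edge i))

data Side : Set where
  L R : Side

_≟ᵇ_ : ∀ {r} → Fin r → Fin r → Bool
i ≟ᵇ j = does (i Fin.≟ j)

full : ∀ {r} → Side → Pos r → Bool
full L (left _)  = true
full R (right _) = true
full _ _         = false

-- Side s of K_{r,r} with its end of the edge (i , j) replaced by that edge.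
exchange : ∀ {r} → Side → Fin r → Fin r → Pos r → Bool
exchange s i j (edge k l) = (j ≟ᵇ l) Bool.∧ (i ≟ᵇ k)
exchange L i j (left k)   = not (i ≟ᵇ k)
exchange R i j (right l)  = not (j ≟ᵇ l)
exchange _ _ _ _          = false

diagonal : ∀ {r} → Pos r → Bool
diagonal (edge k l) = k ≟ᵇ l
diagonal _          = false

faceSet : ∀ {q} → Pos (suc q) → Pos (suc q) → Bool
faceSet (left zero)     = full L
faceSet (left (suc i))  = exchange R (suc i) zero
faceSet (right zero)    = full R
faceSet (right (suc j)) = exchange R (suc j) (suc j)
faceSet (edge i j)      = exchange L i j

≟ᵇ-refl : ∀ {r} (i : Fin r) → i ≟ᵇ i ≡ true
≟ᵇ-refl i = dec-true (i Fin.≟ i) refl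

≟ᵇ-≢ : ∀ {r} {i j : Fin r} → i ≢ j → i ≟ᵇ j ≡ false
≟ᵇ-≢ {i = i} {j} = dec-false (i Fin.≟ j)

exchange-edge : ∀ {r} s (i j k l : Fin r) → exchange s i j (edge k l) ≡ true → k ≡ i × l ≡ j
exchange-edge s i j k l kl∈ with j Fin.≟ l | i Fin.≟ k | kl∈
... | yes j≡l | yes i≡k | _  = sym i≡k , sym j≡l
... | no _    | _       | ()
... | yes _   | no _    | ()

exchange-left : ∀ {r} (i j k : Fin r) → exchange L i j (left k) ≡ true → k ≢ i
exchange-left i j k k∈ refl with () ← trans (cong not (sym (≟ᵇ-refl k))) k∈

exchange-right : ∀ {r} (i j l : Fin r) → exchange R i j (right l) ≡ true → l ≢ j
exchange-right i j l l∈ refl with () ← trans (cong not (sym (≟ᵇ-refl l))) l∈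

full-indep : ∀ {r} s → Independentᴷ {r} (full s)
full-indep L (left _)   (left _)   _  _  ()
full-indep R (right _)  (right _)  _  _  ()
full-indep L (left _)   (right _)  _  ()
full-indep L (left _)   (edge _ _) _  ()
full-indep L (right _)  _          ()
full-indep L (edge _ _) _          ()
full-indep R (right _)  (left _)   _  ()
full-indep R (right _)  (edge _ _) _  ()
full-indep R (left _)   _          ()
full-indep R (edge _ _) _          ()

exchange-indep : ∀ {r} s (i j : Fin r) → Independentᴷ (exchange s i j)
exchange-indep L i j _ _ k∈ kl∈ (left-edge k l) = exchange-left i j k k∈ (proj₁ (exchange-edge L i j k l kl∈))
exchange-indep L i j _ _ kl∈ k∈ (edge-left k l) = exchange-left i j k k∈ (proj₁ (exchange-edge L i j k l kl∈))
exchange-indep R i j _ _ l∈ kl∈ (right-edge k l) = exchange-right i j l l∈ (proj₂ (exchange-edge R i j k l kl∈))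
exchange-indep R i j _ _ kl∈ l∈ (edge-right k l) = exchange-right i j l l∈ (proj₂ (exchange-edge R i j k l kl∈))
exchange-indep s i j _ _ kl∈ kl′∈ (edge-edgeˡ k l l′ l≢l′) =
  l≢l′ (trans (proj₂ (exchange-edge s i j k l kl∈)) (sym (proj₂ (exchange-edge s i j k l′ kl′∈))))
exchange-indep s i j _ _ kl∈ k′l∈ (edge-edgeʳ k k′ l k≢k′) =
  k≢k′ (trans (proj₁ (exchange-edge s i j k l kl∈)) (sym (proj₁ (exchange-edge s i j k′ l k′l∈))))
exchange-indep L i j _ _ _  () (left-right _ _)
exchange-indep L i j _ _ () _  (right-left _ _)
exchange-indep L i j _ _ () _  (right-edge _ _)
exchange-indep L i j _ _ _  () (edge-right _ _)
exchange-indep R i j _ _ () _  (left-right _ _)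
exchange-indep R i j _ _ _  () (right-left _ _)
exchange-indep R i j _ _ () _  (left-edge _ _)
exchange-indep R i j _ _ _  () (edge-left _ _)

diagonal-indep : ∀ {r} → Independentᴷ {r} diagonal
diagonal-indep _ _ kk∈ kl∈ (edge-edgeˡ k k′ l k′≢l) =
  k′≢l (trans (sym (does-sound (k Fin.≟ k′) kk∈)) (does-sound (k Fin.≟ l) kl∈))
diagonal-indep _ _ kl∈ k′l∈ (edge-edgeʳ k k′ l k≢k′) =
  k≢k′ (trans (does-sound (k Fin.≟ l) kl∈) (sym (does-sound (k′ Fin.≟ l) k′l∈)))
diagonal-indep _ _ () _ (left-right _ _)
diagonal-indep _ _ () _ (right-left _ _)
diagonal-indep _ _ () _ (left-edge _ _)
diagonal-indep _ _ _ () (edge-left _ _)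
diagonal-indep _ _ () _ (right-edge _ _)
diagonal-indep _ _ _ () (edge-right _ _)

≟ᵇ-sym : ∀ {r} (i j : Fin r) → i ≟ᵇ j ≡ j ≟ᵇ i
≟ᵇ-sym i j with i Fin.≟ j
... | yes refl = sym (≟ᵇ-refl i)
... | no i≢j   = sym (≟ᵇ-≢ (i≢j ∘ sym))

sum-pick : ∀ k (y : Fin k → ℚ) i → sumFin k (λ j → y j * ind (j ≟ᵇ i)) ≡ y i
sum-pick k y i = trans (sum-single k _ i (λ j j≢i → trans (cong (λ b → y j * ind b) (≟ᵇ-≢ j≢i)) (ℚ.*-zeroʳ (y j))))
  (trans (cong (λ b → y i * ind b) (≟ᵇ-refl i)) (ℚ.*-identityʳ (y i)))

sum-pick-pair : ∀ k (α : Fin k → Fin k → ℚ) i j →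
  sumFin k (λ i′ → sumFin k (λ j′ → α i′ j′ * ind ((j′ ≟ᵇ j) Bool.∧ (i′ ≟ᵇ i)))) ≡ α i j
sum-pick-pair k α i j = trans (sum-cong k row-pick) (sum-pick k (λ i′ → α i′ j) i)
  where
  row-pick : ∀ i′ → sumFin k (λ j′ → α i′ j′ * ind ((j′ ≟ᵇ j) Bool.∧ (i′ ≟ᵇ i))) ≡ α i′ j * ind (i′ ≟ᵇ i)
  row-pick i′ = trans (sum-single k _ j (λ j′ j′≢j → trans (cong (λ b → α i′ j′ * ind (b Bool.∧ (i′ ≟ᵇ i))) (≟ᵇ-≢ j′≢j))
                                                          (ℚ.*-zeroʳ (α i′ j′))))
                      (cong (λ b → α i′ j * ind (b Bool.∧ (i′ ≟ᵇ i))) (≟ᵇ-refl j))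

sum-except : ∀ k (y : Fin k → ℚ) i → sumFin k (λ j → y j * ind (not (j ≟ᵇ i))) + y i ≡ sumFin k y
sum-except (suc k) y i = begin
  sumFin (suc k) (λ j → y j * ind (not (j ≟ᵇ i))) + y i
    ≡⟨ cong (_+ y i) (sum-punchIn k (λ j → y j * ind (not (j ≟ᵇ i))) i) ⟩
  (y i * ind (not (i ≟ᵇ i)) + sumFin k (λ j → y (punchIn i j) * ind (not (punchIn i j ≟ᵇ i)))) + y i
    ≡⟨ cong₂ (λ b s → (y i * ind (not b) + s) + y i) (≟ᵇ-refl i)
             (sum-cong k (λ j → trans (cong (λ b → y (punchIn i j) * ind (not b)) (≟ᵇ-≢ (Fin.punchInᵢ≢i i j)))
                                      (ℚ.*-identityʳ _))) ⟩
  (y i * 0ℚ + sumFin k (y ∘ punchIn i)) + y i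
    ≡⟨ solve 2 (λ a s → (a :* con 0ℚ :+ s) :+ a := a :+ s) refl (y i) _ ⟩
  y i + sumFin k (y ∘ punchIn i)
    ≡⟨ sum-punchIn k y i ⟨
  sumFin (suc k) y
    ∎
  where open ≡-Reasoning

count-except : ∀ k (i : Fin (suc k)) → sumFin (suc k) (λ j → ind (not (i ≟ᵇ j))) + 1ℚ ≡ ℕtoℚ (suc k)
count-except k i = begin
  sumFin (suc k) (λ j → ind (not (i ≟ᵇ j))) + 1ℚ
    ≡⟨ cong (_+ 1ℚ) (sum-cong (suc k) (λ j → trans (ℚ.*-identityˡ _) (cong (ind ∘ not) (≟ᵇ-sym j i)))) ⟨
  sumFin (suc k) (λ j → 1ℚ * ind (not (j ≟ᵇ i))) + 1ℚ
    ≡⟨ sum-except (suc k) (λ _ → 1ℚ) i ⟩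
  sumFin (suc k) (λ _ → 1ℚ)
    ≡⟨ sum-ones (suc k) ⟩
  ℕtoℚ (suc k)
    ∎
  where open ≡-Reasoning

count-full : ∀ r s → sumᴷ r (ind ∘ full s) ≡ ℕtoℚ r
count-full r L = trans (cong₂ _+_ (cong₂ _+_ (sum-ones r) (sum-zero r (λ _ → refl)))
                                  (sum-zero r (λ _ → sum-zero r (λ _ → refl))))
                       (trans (ℚ.+-identityʳ _) (ℚ.+-identityʳ _))
count-full r R = trans (cong₂ _+_ (cong₂ _+_ (sum-zero r (λ _ → refl)) (sum-ones r))
                                  (sum-zero r (λ _ → sum-zero r (λ _ → refl))))
                       (trans (ℚ.+-identityʳ _) (ℚ.+-identityˡ _))

count-edge : ∀ k (i j : Fin k) → sumFin k (λ k′ → sumFin k (λ l′ → ind ((j ≟ᵇ l′) Bool.∧ (i ≟ᵇ k′)))) ≡ 1ℚ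
count-edge k i j = trans (sum-cong k (λ k′ → sum-cong k (λ l′ → trans (cong₂ (λ b c → ind (b Bool.∧ c)) (≟ᵇ-sym j l′) (≟ᵇ-sym i k′))
                                                                       (sym (ℚ.*-identityˡ _)))))
                         (sum-pick-pair k (λ _ _ → 1ℚ) i j)

count-exchange : ∀ {q} s (i j : Fin (suc q)) → sumᴷ (suc q) (ind ∘ exchange s i j) ≡ ℕtoℚ (suc q)
count-exchange {q} L i j = begin
  (ΣL + sumFin (suc q) (λ _ → 0ℚ)) + ΣE ≡⟨ cong₂ _+_ (trans (cong (ΣL +_) (sum-zero (suc q) (λ _ → refl))) (ℚ.+-identityʳ ΣL))
                                                     (count-edge (suc q) i j) ⟩
  ΣL + 1ℚ                               ≡⟨ count-except q i ⟩
  ℕtoℚ (suc q)                          ∎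
  where
  open ≡-Reasoning
  ΣL = sumFin (suc q) (λ k → ind (not (i ≟ᵇ k)))
  ΣE = sumFin (suc q) (λ k → sumFin (suc q) (λ l → ind ((j ≟ᵇ l) Bool.∧ (i ≟ᵇ k))))
count-exchange {q} R i j = begin
  (sumFin (suc q) (λ _ → 0ℚ) + ΣR) + ΣE ≡⟨ cong₂ _+_ (trans (cong (_+ ΣR) (sum-zero (suc q) (λ _ → refl))) (ℚ.+-identityˡ ΣR))
                                                     (count-edge (suc q) i j) ⟩
  ΣR + 1ℚ                               ≡⟨ count-except q j ⟩
  ℕtoℚ (suc q)                          ∎
  where
  open ≡-Reasoning
  ΣR = sumFin (suc q) (λ l → ind (not (j ≟ᵇ l)))
  ΣE = sumFin (suc q) (λ k → sumFin (suc q) (λ l → ind ((j ≟ᵇ l) Bool.∧ (i ≟ᵇ k))))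

count-diagonal : ∀ r → sumᴷ r (ind ∘ diagonal) ≡ ℕtoℚ r
count-diagonal r = begin
  (sumFin r (λ _ → 0ℚ) + sumFin r (λ _ → 0ℚ)) + sumFin r (λ i → sumFin r (λ j → ind (i ≟ᵇ j)))
    ≡⟨ cong₂ _+_ (cong₂ _+_ (sum-zero r (λ _ → refl)) (sum-zero r (λ _ → refl))) (sum-cong r row-count) ⟩
  (0ℚ + 0ℚ) + sumFin r (λ _ → 1ℚ)
    ≡⟨ trans (ℚ.+-identityˡ _) (sum-ones r) ⟩
  ℕtoℚ r
    ∎
  where
  open ≡-Reasoning
  row-count : ∀ i → sumFin r (λ j → ind (i ≟ᵇ j)) ≡ 1ℚ
  row-count i = trans (sum-cong r (λ j → trans (cong ind (≟ᵇ-sym i j)) (sym (ℚ.*-identityˡ _)))) (sum-pick r (λ _ → 1ℚ) i)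

count-faceSet : ∀ {q} (x : Pos (suc q)) → sumᴷ (suc q) (ind ∘ faceSet x) ≡ ℕtoℚ (suc q)
count-faceSet {q} (left zero)  = count-full (suc q) L
count-faceSet (left (suc i))  = count-exchange R (suc i) zero
count-faceSet {q} (right zero) = count-full (suc q) R
count-faceSet (right (suc j)) = count-exchange R (suc j) (suc j)
count-faceSet (edge i j)      = count-exchange L i j

faceSet-indep : ∀ {q} (x : Pos (suc q)) → Independentᴷ (faceSet x)
faceSet-indep (left zero)     = full-indep L
faceSet-indep (left (suc i))  = exchange-indep R (suc i) zero
faceSet-indep (right zero)    = full-indep R
faceSet-indep (right (suc j)) = exchange-indep R (suc j) (suc j)
faceSet-indep (edge i j)      = exchange-indep L i j

sum-*0 : ∀ k (y : Fin k → ℚ) → sumFin k (λ i → y i * 0ℚ) ≡ 0ℚ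
sum-*0 k y = sum-zero k (λ i → ℚ.*-zeroʳ (y i))

sum-*1 : ∀ k (y : Fin k → ℚ) → sumFin k (λ i → y i * 1ℚ) ≡ sumFin k y
sum-*1 k y = sum-cong k (λ i → ℚ.*-identityʳ (y i))

-- Solving the linear system: the coordinates at edges express every edge weight through the vertex
-- weights, those at the left vertices force all row sums to vanish, and those at the right vertices
-- force the remaining weights to vanish, using r ≠ 0.
module _ {q : ℕ} (ν : Pos (suc q) → ℚ)
         (νF≡0 : ∀ y → sumᴷ (suc q) (λ x → ν x * ind (faceSet x y)) ≡ 0ℚ) where

  private
    a₀ b₀ : ℚ
    a₀ = ν (left zero)
    b₀ = ν (right zero)
    a b : Fin q → ℚ
    a i = ν (left (suc i))
    b j = ν (right (suc j))
    α : Fin (suc q) → Fin (suc q) → ℚ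
    α i j = ν (edge i j)
    ρ : Fin (suc q) → ℚ
    ρ i = sumFin (suc q) (α i)

    edge-equation : ∀ k l {u v} →
      sumFin q (λ i → a i * ind ((zero ≟ᵇ l) Bool.∧ (suc i ≟ᵇ k))) ≡ u →
      sumFin q (λ j → b j * ind ((suc j ≟ᵇ l) Bool.∧ (suc j ≟ᵇ k))) ≡ v →
      α k l + (u + v) ≡ 0ℚ
    edge-equation k l {u} {v} A≡u B≡v = begin
      α k l + (u + v)
        ≡⟨ solve 5 (λ x y z u v → z :+ (u :+ v) := (x :* con 0ℚ :+ u) :+ (y :* con 0ℚ :+ v) :+ z) refl a₀ b₀ (α k l) u v ⟩
      (a₀ * 0ℚ + u) + (b₀ * 0ℚ + v) + α k l
        ≡⟨ cong₂ (λ s t → (a₀ * 0ℚ + s) + (b₀ * 0ℚ + t) + α k l) A≡u B≡v ⟨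
      (a₀ * 0ℚ + A) + (b₀ * 0ℚ + B) + α k l
        ≡⟨ cong ((a₀ * 0ℚ + A) + (b₀ * 0ℚ + B) +_) (sum-pick-pair (suc q) α k l) ⟨
      sumᴷ (suc q) (λ x → ν x * ind (faceSet x (edge k l)))
        ≡⟨ νF≡0 (edge k l) ⟩
      0ℚ ∎
      where
      open ≡-Reasoning
      A = sumFin q (λ i → a i * ind ((zero ≟ᵇ l) Bool.∧ (suc i ≟ᵇ k)))
      B = sumFin q (λ j → b j * ind ((suc j ≟ᵇ l) Bool.∧ (suc j ≟ᵇ k)))

    edge-row₀ : ∀ l → α zero l ≡ 0ℚ
    edge-row₀ l = x+y≡0∧y≡0⇒x≡0 (edge-equation zero l
      (sum-zero q (λ i → trans (cong (λ c → a i * ind c) (∧-zeroʳ (zero ≟ᵇ l))) (ℚ.*-zeroʳ (a i))))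
      (sum-zero q (λ j → trans (cong (λ c → b j * ind c) (∧-zeroʳ (suc j ≟ᵇ l))) (ℚ.*-zeroʳ (b j)))))
      refl

    edge-column₀ : ∀ k → α (suc k) zero + a k ≡ 0ℚ
    edge-column₀ k = trans (cong (α (suc k) zero +_) (sym (ℚ.+-identityʳ (a k))))
      (edge-equation (suc k) zero (sum-pick q a k) (sum-*0 q b))

    edge-diagonal : ∀ k → α (suc k) (suc k) + b k ≡ 0ℚ
    edge-diagonal k = trans (cong (α (suc k) (suc k) +_) (sym (ℚ.+-identityˡ (b k))))
      (edge-equation (suc k) (suc k) (sum-*0 q a)
        (trans (sum-cong q (λ j → cong (λ c → b j * ind c) (∧-idem (j ≟ᵇ k)))) (sum-pick q b k)))

    edge-off-diagonal : ∀ k l → k ≢ l → α (suc k) (suc l) ≡ 0ℚ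
    edge-off-diagonal k l k≢l = x+y≡0∧y≡0⇒x≡0 (edge-equation (suc k) (suc l) (sum-*0 q a)
      (sum-zero q (λ j → trans (cong (λ c → b j * ind c) (not-both j)) (ℚ.*-zeroʳ (b j)))))
      refl
      where
      not-both : ∀ j → (j ≟ᵇ l) Bool.∧ (j ≟ᵇ k) ≡ false
      not-both j with j Fin.≟ l
      ... | yes refl = ≟ᵇ-≢ (k≢l ∘ sym)
      ... | no _     = refl

    ρ-zero : ρ zero ≡ 0ℚ
    ρ-zero = sum-zero (suc q) edge-row₀

    ρ-suc : ∀ k → ρ (suc k) + (a k + b k) ≡ 0ℚ
    ρ-suc k = begin
      (α (suc k) zero + sumFin q (α (suc k) ∘ suc)) + (a k + b k)
        ≡⟨ cong (λ z → (α (suc k) zero + z) + (a k + b k))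
                (sum-single q _ k (λ l l≢k → edge-off-diagonal k l (l≢k ∘ sym))) ⟩
      (α (suc k) zero + α (suc k) (suc k)) + (a k + b k)
        ≡⟨ +-interchange (α (suc k) zero) _ (a k) (b k) ⟩
      (α (suc k) zero + a k) + (α (suc k) (suc k) + b k)
        ≡⟨ cong₂ _+_ (edge-column₀ k) (edge-diagonal k) ⟩
      0ℚ ∎
      where open ≡-Reasoning

    left-equation : ∀ k → a₀ + sumFin (suc q) (λ i → ρ i * ind (not (i ≟ᵇ k))) ≡ 0ℚ
    left-equation k = trans (sym unfolded) (νF≡0 (left k))
      where
      open ≡-Reasoning
      E = sumFin (suc q) (λ i → sumFin (suc q) (λ j → α i j * ind (not (i ≟ᵇ k))))
      unfolded : sumᴷ (suc q) (λ x → ν x * ind (faceSet x (left k))) ≡ a₀ + sumFin (suc q) (λ i → ρ i * ind (not (i ≟ᵇ k)))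
      unfolded = begin
        ((a₀ * 1ℚ + sumFin q (λ i → a i * 0ℚ)) + (b₀ * 0ℚ + sumFin q (λ j → b j * 0ℚ))) + E
          ≡⟨ cong₂ (λ s t → ((a₀ * 1ℚ + s) + (b₀ * 0ℚ + t)) + E) (sum-*0 q a) (sum-*0 q b) ⟩
        ((a₀ * 1ℚ + 0ℚ) + (b₀ * 0ℚ + 0ℚ)) + E
          ≡⟨ solve 3 (λ x y e → ((x :* con 1ℚ :+ con 0ℚ) :+ (y :* con 0ℚ :+ con 0ℚ)) :+ e := x :+ e) refl a₀ b₀ E ⟩
        a₀ + E
          ≡⟨ cong (a₀ +_) (sum-cong (suc q) (λ i → sum-*ʳ (suc q) (ind (not (i ≟ᵇ k))) (α i))) ⟩
        a₀ + sumFin (suc q) (λ i → ρ i * ind (not (i ≟ᵇ k)))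
          ∎

    right-equation₀ : b₀ + sumFin q b ≡ 0ℚ
    right-equation₀ = trans (sym unfolded) (νF≡0 (right zero))
      where
      open ≡-Reasoning
      E = sumFin (suc q) (λ i → sumFin (suc q) (λ j → α i j * 0ℚ))
      unfolded : sumᴷ (suc q) (λ x → ν x * ind (faceSet x (right zero))) ≡ b₀ + sumFin q b
      unfolded = begin
        ((a₀ * 0ℚ + sumFin q (λ i → a i * 0ℚ)) + (b₀ * 1ℚ + sumFin q (λ j → b j * 1ℚ))) + E
          ≡⟨ cong₂ _+_ (cong₂ (λ s t → (a₀ * 0ℚ + s) + (b₀ * 1ℚ + t)) (sum-*0 q a) (sum-*1 q b))
                       (sum-zero (suc q) (λ i → sum-*0 (suc q) (α i))) ⟩
        ((a₀ * 0ℚ + 0ℚ) + (b₀ * 1ℚ + sumFin q b)) + 0ℚ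
          ≡⟨ solve 3 (λ x y t → ((x :* con 0ℚ :+ con 0ℚ) :+ (y :* con 1ℚ :+ t)) :+ con 0ℚ := y :+ t) refl a₀ b₀ _ ⟩
        b₀ + sumFin q b
          ∎

    right-equation : ∀ l → sumFin q a + (b₀ + sumFin q (λ j → b j * ind (not (j ≟ᵇ l)))) ≡ 0ℚ
    right-equation l = trans (sym unfolded) (νF≡0 (right (suc l)))
      where
      open ≡-Reasoning
      E = sumFin (suc q) (λ i → sumFin (suc q) (λ j → α i j * 0ℚ))
      B = sumFin q (λ j → b j * ind (not (j ≟ᵇ l)))
      unfolded : sumᴷ (suc q) (λ x → ν x * ind (faceSet x (right (suc l)))) ≡ sumFin q a + (b₀ + B)
      unfolded = begin
        ((a₀ * 0ℚ + sumFin q (λ i → a i * 1ℚ)) + (b₀ * 1ℚ + B)) + E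
          ≡⟨ cong₂ (λ s u → ((a₀ * 0ℚ + s) + (b₀ * 1ℚ + B)) + u) (sum-*1 q a)
                   (sum-zero (suc q) (λ i → sum-*0 (suc q) (α i))) ⟩
        ((a₀ * 0ℚ + sumFin q a) + (b₀ * 1ℚ + B)) + 0ℚ
          ≡⟨ solve 4 (λ x s y t → ((x :* con 0ℚ :+ s) :+ (y :* con 1ℚ :+ t)) :+ con 0ℚ := s :+ (y :+ t))
                   refl a₀ (sumFin q a) b₀ B ⟩
        sumFin q a + (b₀ + B)
          ∎

    ρ-constant : ∀ k → ρ k ≡ sumFin (suc q) ρ + a₀
    ρ-constant k = begin
      ρ k                       ≡⟨ solve 3 (λ x p a → p := (x :+ p) :+ a :- (a :+ x)) refl X (ρ k) a₀ ⟩
      (X + ρ k) + a₀ - (a₀ + X) ≡⟨ cong₂ (λ s t → s + a₀ - t) (sum-except (suc q) ρ k) (left-equation k) ⟩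
      sumFin (suc q) ρ + a₀ - 0ℚ ≡⟨ ℚ.+-identityʳ _ ⟩
      sumFin (suc q) ρ + a₀     ∎
      where
      open ≡-Reasoning
      X = sumFin (suc q) (λ i → ρ i * ind (not (i ≟ᵇ k)))

    ρ≡0 : ∀ k → ρ k ≡ 0ℚ
    ρ≡0 k = trans (ρ-constant k) (trans (sym (ρ-constant zero)) ρ-zero)

    a₀≡0 : a₀ ≡ 0ℚ
    a₀≡0 = x+y≡0∧y≡0⇒x≡0 (left-equation zero)
      (sum-zero (suc q) (λ i → trans (cong (_* ind (not (i ≟ᵇ zero))) (ρ≡0 i)) (ℚ.*-zeroˡ (ind (not (i ≟ᵇ zero))))))

    a+b≡0 : ∀ k → a k + b k ≡ 0ℚ
    a+b≡0 k = trans (sym (ℚ.+-identityˡ _)) (trans (cong (_+ (a k + b k)) (sym (ρ≡0 (suc k)))) (ρ-suc k))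

    b≡Σa : ∀ l → b l ≡ sumFin q a
    b≡Σa l = begin
      b l
        ≡⟨ solve 4 (λ Y b a c → b := (Y :+ b) :- (a :+ (c :+ Y)) :+ a :+ c) refl Y (b l) Σa b₀ ⟩
      (Y + b l) - (Σa + (b₀ + Y)) + Σa + b₀
        ≡⟨ cong₂ (λ s t → s - t + Σa + b₀) (sum-except q b l) (right-equation l) ⟩
      sumFin q b - 0ℚ + Σa + b₀
        ≡⟨ solve 3 (λ s a c → s :- con 0ℚ :+ a :+ c := (c :+ s) :+ a) refl (sumFin q b) Σa b₀ ⟩
      (b₀ + sumFin q b) + Σa
        ≡⟨ cong (_+ Σa) right-equation₀ ⟩
      0ℚ + Σa
        ≡⟨ ℚ.+-identityˡ Σa ⟩
      Σa ∎
      where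
      open ≡-Reasoning
      Σa = sumFin q a
      Y = sumFin q (λ j → b j * ind (not (j ≟ᵇ l)))

    a≡-Σa : ∀ l → a l ≡ - sumFin q a
    a≡-Σa l = begin
      a l                  ≡⟨ solve 2 (λ x y → x := (x :+ y) :- y) refl (a l) (b l) ⟩
      (a l + b l) - b l    ≡⟨ cong₂ _-_ (a+b≡0 l) (b≡Σa l) ⟩
      0ℚ - sumFin q a      ≡⟨ ℚ.+-identityˡ _ ⟩
      - sumFin q a         ∎
      where open ≡-Reasoning

    Σa≡0 : sumFin q a ≡ 0ℚ
    Σa≡0 = p≢0∧p*q≡0⇒q≡0 (ℕtoℚ (suc q)) Σa (ℕtoℚ-suc≢0 q) (begin
      ℕtoℚ (suc q) * Σa                   ≡⟨ cong (_* Σa) (sum-ones (suc q)) ⟨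
      sumFin (suc q) (λ _ → 1ℚ) * Σa      ≡⟨ sum-*ʳ (suc q) Σa (λ _ → 1ℚ) ⟨
      sumFin (suc q) (λ _ → 1ℚ * Σa)      ≡⟨ sum-cong (suc q) (λ _ → ℚ.*-identityˡ Σa) ⟩
      Σa + sumFin q (λ _ → Σa)            ≡⟨ cong (_+ sumFin q (λ _ → Σa)) Σa≡-∑Σa ⟩
      - sumFin q (λ _ → Σa) + sumFin q (λ _ → Σa)
                                          ≡⟨ ℚ.+-inverseˡ (sumFin q (λ _ → Σa)) ⟩
      0ℚ                                  ∎)
      where
      open ≡-Reasoning
      Σa = sumFin q a
      Σa≡-∑Σa : Σa ≡ - sumFin q (λ _ → Σa)
      Σa≡-∑Σa = trans (sum-cong q a≡-Σa) (sum-neg q (λ _ → Σa))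

    a≡0 : ∀ l → a l ≡ 0ℚ
    a≡0 l = trans (a≡-Σa l) (cong -_ Σa≡0)

    b≡0 : ∀ l → b l ≡ 0ℚ
    b≡0 l = trans (b≡Σa l) Σa≡0

    b₀≡0 : b₀ ≡ 0ℚ
    b₀≡0 = x+y≡0∧y≡0⇒x≡0 right-equation₀ (sum-zero q b≡0)

  faceSets-independent : ∀ x → ν x ≡ 0ℚ
  faceSets-independent (left zero)          = a₀≡0
  faceSets-independent (left (suc i))       = a≡0 i
  faceSets-independent (right zero)         = b₀≡0
  faceSets-independent (right (suc j))      = b≡0 j
  faceSets-independent (edge zero l)        = edge-row₀ l
  faceSets-independent (edge (suc k) zero)  = x+y≡0∧y≡0⇒x≡0 (edge-column₀ k) (a≡0 k)
  faceSets-independent (edge (suc k) (suc l)) with k Fin.≟ l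
  ... | yes refl = x+y≡0∧y≡0⇒x≡0 (edge-diagonal k) (b≡0 k)
  ... | no k≢l   = edge-off-diagonal k l k≢l

-- An induced copy of K_{r,r} in G

module InducedBiclique (G : Graph) (q : ℕ) (f : Fin (suc q) ⊎ Fin (suc q) → Fin (Graph.n G))
                       (H : InducedKrr G (suc q) f) where
  open Graph G

  a b : Fin (suc q) → Fin n
  a i = f (inj₁ i)
  b j = f (inj₂ j)

  e : Fin (suc q) → Fin (suc q) → Fin m
  e i j = proj₁ (proj₁ (proj₂ H) i j)

  e-joins : ∀ i j → Joins G (a i) (b j) (e i j)
  e-joins i j = proj₂ (proj₁ (proj₂ H) i j)

  a-injective : ∀ {i k} → a i ≡ a k → i ≡ k
  a-injective = inj₁-injective ∘ proj₁ H

  b-injective : ∀ {j l} → b j ≡ b l → j ≡ l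
  b-injective = inj₂-injective ∘ proj₁ H

  a≢b : ∀ {i j} → a i ≢ b j
  a≢b a≡b with () ← proj₁ H a≡b

  e-endpoint : ∀ {v i j} → Endpoint G v (e i j) → a i ≡ v ⊎ b j ≡ v
  e-endpoint {v} {i} {j} ep with e-joins i j | ep
  ... | inj₁ (s≡a , _)   | inj₁ s≡v = inj₁ (trans (sym s≡a) s≡v)
  ... | inj₁ (_ , t≡b)   | inj₂ t≡v = inj₂ (trans (sym t≡b) t≡v)
  ... | inj₂ (s≡b , _)   | inj₁ s≡v = inj₂ (trans (sym s≡b) s≡v)
  ... | inj₂ (_ , t≡a)   | inj₂ t≡v = inj₁ (trans (sym t≡a) t≡v)

  a-endpoint : ∀ i j → Endpoint G (a i) (e i j)
  a-endpoint i j = ⊎.map proj₁ proj₂ (e-joins i j)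

  b-endpoint : ∀ i j → Endpoint G (b j) (e i j)
  b-endpoint i j = ⊎.swap (⊎.map proj₂ proj₁ (e-joins i j))

  e-injective : ∀ {i j k l} → e i j ≡ e k l → i ≡ k × j ≡ l
  e-injective {i} {j} {k} {l} eq with e-endpoint (subst (Endpoint G (a i)) eq (a-endpoint i j))
                                    | e-endpoint (subst (Endpoint G (b j)) eq (b-endpoint i j))
  ... | inj₁ aₖ≡aᵢ | inj₂ bₗ≡bⱼ = sym (a-injective aₖ≡aᵢ) , sym (b-injective bₗ≡bⱼ)
  ... | inj₂ bₗ≡aᵢ | _          = ⊥-elim (a≢b (sym bₗ≡aᵢ))
  ... | _          | inj₁ aₖ≡bⱼ = ⊥-elim (a≢b aₖ≡bⱼ)

  embed : Pos (suc q) → Elt G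
  embed (left i)   = inj₁ (a i)
  embed (right j)  = inj₁ (b j)
  embed (edge i j) = inj₂ (e i j)

  embed-injective : ∀ {x y} → embed x ≡ embed y → x ≡ y
  embed-injective {left i}   {left k}   eq = cong left (a-injective (inj₁-injective eq))
  embed-injective {left i}   {right l}  eq = ⊥-elim (a≢b (inj₁-injective eq))
  embed-injective {right j}  {left k}   eq = ⊥-elim (a≢b (sym (inj₁-injective eq)))
  embed-injective {right j}  {right l}  eq = cong right (b-injective (inj₁-injective eq))
  embed-injective {edge i j} {edge k l} eq with refl , refl ← e-injective (inj₂-injective eq) = refl
  embed-injective {left _}   {edge _ _} ()
  embed-injective {right _}  {edge _ _} ()
  embed-injective {edge _ _} {left _}   ()
  embed-injective {edge _ _} {right _}  ()

  InH′ : Elt G → Set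
  InH′ = InH G (suc q) f

  embed-InH : ∀ x → InH′ (embed x)
  embed-InH (left i)   = inj₁ i , refl
  embed-InH (right j)  = inj₂ j , refl
  embed-InH (edge i j) with e-joins i j
  ... | inj₁ (s≡a , t≡b) = (inj₁ i , sym s≡a) , (inj₂ j , sym t≡b)
  ... | inj₂ (s≡b , t≡a) = (inj₂ j , sym s≡b) , (inj₁ i , sym t≡a)

  data VertexLocation (v : Fin n) : Set where
    on-left  : ∀ i → a i ≡ v → VertexLocation v
    on-right : ∀ j → b j ≡ v → VertexLocation v
    off      : ¬ InHV G (suc q) f v → VertexLocation v

  locateVertex : ∀ v → VertexLocation v
  locateVertex v with Fin.any? (λ i → a i Fin.≟ v) | Fin.any? (λ j → b j Fin.≟ v)
  ... | yes (i , aᵢ≡v) | _              = on-left i aᵢ≡v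
  ... | no _           | yes (j , bⱼ≡v) = on-right j bⱼ≡v
  ... | no ¬left       | no ¬right      = off λ where
    (inj₁ i , aᵢ≡v) → ¬left (i , aᵢ≡v)
    (inj₂ j , bⱼ≡v) → ¬right (j , bⱼ≡v)

  data Location (x′ : Elt G) : Set where
    inside  : ∀ x → embed x ≡ x′ → Location x′
    outside : ¬ InH′ x′ → Location x′

  locate : ∀ x′ → Location x′
  locate (inj₁ v) with locateVertex v
  ... | on-left i aᵢ≡v  = inside (left i) (cong inj₁ aᵢ≡v)
  ... | on-right j bⱼ≡v = inside (right j) (cong inj₁ bⱼ≡v)
  ... | off v∉H         = outside v∉H
  locate (inj₂ ε) with locateVertex (src ε) | locateVertex (tgt ε)
  ... | on-left i aᵢ≡s  | on-right j bⱼ≡t =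
    inside (edge i j) (cong inj₂ (Joins-unique G (e-joins i j) (inj₁ (sym aᵢ≡s , sym bⱼ≡t))))
  ... | on-right j bⱼ≡s | on-left i aᵢ≡t  =
    inside (edge i j) (cong inj₂ (Joins-unique G (e-joins i j) (inj₂ (sym bⱼ≡s , sym aᵢ≡t))))
  ... | on-left i aᵢ≡s  | on-left k aₖ≡t  = ⊥-elim (proj₁ (proj₂ (proj₂ H)) i k ε (inj₁ (sym aᵢ≡s , sym aₖ≡t)))
  ... | on-right j bⱼ≡s | on-right l bₗ≡t = ⊥-elim (proj₂ (proj₂ (proj₂ H)) j l ε (inj₁ (sym bⱼ≡s , sym bₗ≡t)))
  ... | off s∉H         | _               = outside (s∉H ∘ proj₁)
  ... | on-left _ _     | off t∉H         = outside (t∉H ∘ proj₂)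
  ... | on-right _ _    | off t∉H         = outside (t∉H ∘ proj₂)

  embed-adjacent : ∀ x y → Adjᴷ x y → Adj G (embed x) (embed y)
  embed-adjacent _ _ (left-right i j)      = a≢b , e i j , e-joins i j
  embed-adjacent _ _ (right-left i j)      = a≢b ∘ sym , e i j , Joins-sym G (e-joins i j)
  embed-adjacent _ _ (left-edge i j)       = a-endpoint i j
  embed-adjacent _ _ (edge-left i j)       = a-endpoint i j
  embed-adjacent _ _ (right-edge i j)      = b-endpoint i j
  embed-adjacent _ _ (edge-right i j)      = b-endpoint i j
  embed-adjacent _ _ (edge-edgeˡ i j l j≢l) =
    j≢l ∘ proj₂ ∘ e-injective , a i , a-endpoint i j , a-endpoint i l
  embed-adjacent _ _ (edge-edgeʳ i k j i≢k) =
    i≢k ∘ proj₁ ∘ e-injective , b j , b-endpoint i j , b-endpoint k j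

  adjacent-embed : ∀ x y → Adj G (embed x) (embed y) → Adjᴷ x y
  adjacent-embed (left i)   (left k)   (_ , ε , J) = ⊥-elim (proj₁ (proj₂ (proj₂ H)) i k ε J)
  adjacent-embed (right j)  (right l)  (_ , ε , J) = ⊥-elim (proj₂ (proj₂ (proj₂ H)) j l ε J)
  adjacent-embed (left i)   (right j)  _ = left-right i j
  adjacent-embed (right j)  (left i)   _ = right-left i j
  adjacent-embed (left i)   (edge k l) ep with e-endpoint ep
  ... | inj₁ aₖ≡aᵢ with refl ← a-injective aₖ≡aᵢ = left-edge k l
  ... | inj₂ bₗ≡aᵢ = ⊥-elim (a≢b (sym bₗ≡aᵢ))
  adjacent-embed (edge k l) (left i)   ep with e-endpoint ep
  ... | inj₁ aₖ≡aᵢ with refl ← a-injective aₖ≡aᵢ = edge-left k l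
  ... | inj₂ bₗ≡aᵢ = ⊥-elim (a≢b (sym bₗ≡aᵢ))
  adjacent-embed (right j)  (edge k l) ep with e-endpoint ep
  ... | inj₁ aₖ≡bⱼ = ⊥-elim (a≢b aₖ≡bⱼ)
  ... | inj₂ bₗ≡bⱼ with refl ← b-injective bₗ≡bⱼ = right-edge k l
  adjacent-embed (edge k l) (right j)  ep with e-endpoint ep
  ... | inj₁ aₖ≡bⱼ = ⊥-elim (a≢b aₖ≡bⱼ)
  ... | inj₂ bₗ≡bⱼ with refl ← b-injective bₗ≡bⱼ = edge-right k l
  adjacent-embed (edge i j) (edge k l) (e≢e′ , v , ep , ep′) with e-endpoint ep | e-endpoint ep′
  ... | inj₁ aᵢ≡v | inj₁ aₖ≡v with refl ← a-injective (trans aᵢ≡v (sym aₖ≡v)) =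
    edge-edgeˡ i j l (e≢e′ ∘ cong (e i))
  ... | inj₂ bⱼ≡v | inj₂ bₗ≡v with refl ← b-injective (trans bⱼ≡v (sym bₗ≡v)) =
    edge-edgeʳ i k j (e≢e′ ∘ cong (λ z → e z j))
  ... | inj₁ aᵢ≡v | inj₂ bₗ≡v = ⊥-elim (a≢b (trans aᵢ≡v (sym bₗ≡v)))
  ... | inj₂ bⱼ≡v | inj₁ aₖ≡v = ⊥-elim (a≢b (trans aₖ≡v (sym bⱼ≡v)))

  liftAt : (Pos (suc q) → Bool) → ∀ {x′} → Location x′ → Bool
  liftAt S (inside x _) = S x
  liftAt S (outside _)  = false

  lift : (Pos (suc q) → Bool) → Elt G → Bool
  lift S x′ = liftAt S (locate x′)

  lift-embed : ∀ S x → lift S (embed x) ≡ S x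
  lift-embed S x = liftAt-inside (locate (embed x)) refl
    where
    liftAt-inside : ∀ {x′} (ℓ : Location x′) → embed x ≡ x′ → liftAt S ℓ ≡ S x
    liftAt-inside (inside y y↦x′) x↦x′ = cong S (embed-injective (trans y↦x′ (sym x↦x′)))
    liftAt-inside (outside x′∉H) refl = ⊥-elim (x′∉H (embed-InH x))

  lift-outside : ∀ S {x′} → ¬ InH′ x′ → lift S x′ ≡ false
  lift-outside S {x′} x′∉H = liftAt-outside (locate x′)
    where
    liftAt-outside : (ℓ : Location x′) → liftAt S ℓ ≡ false
    liftAt-outside (inside x refl) = ⊥-elim (x′∉H (embed-InH x))
    liftAt-outside (outside _)     = refl

  lift-true : ∀ S x′ → lift S x′ ≡ true → ∃[ x ] (embed x ≡ x′ × S x ≡ true)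
  lift-true S x′ = liftAt-true (locate x′)
    where
    liftAt-true : (ℓ : Location x′) → liftAt S ℓ ≡ true → ∃[ x ] (embed x ≡ x′ × S x ≡ true)
    liftAt-true (inside x x↦x′) Sx = x , x↦x′ , Sx

  lift-matching : ∀ S → Independentᴷ S → TotalMatching G (lift S)
  lift-matching S S-indep x′ y′ x′∈ y′∈ _ adj with lift-true S x′ x′∈ | lift-true S y′ y′∈
  ... | x , refl , Sx | y , refl , Sy = S-indep x y Sx Sy (adjacent-embed x y adj)

  restrict-matching : ∀ T → TotalMatching G T → Independentᴷ (T ∘ embed)
  restrict-matching T T-matching x y Tx Ty adj =
    T-matching (embed x) (embed y) Tx Ty (λ x≡y → Adjᴷ-irreflexive (subst (Adjᴷ x) (embed-injective (sym x≡y)) adj))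
      (embed-adjacent x y adj)

  sum-over-H : ∀ (g : Elt G → ℚ) → (∀ x′ → ¬ InH′ x′ → g x′ ≡ 0ℚ) → sum⊎ n m g ≡ sumᴷ (suc q) (g ∘ embed)
  sum-over-H g g-off = begin
    sum⊎ n m g
      ≡⟨ sum⊎-cong decompose ⟩
    sum⊎ n m (λ x′ → sumᴷ (suc q) (λ x → g (embed x) * χ G (singleton G (embed x)) x′))
      ≡⟨ sum⊎-sumᴷ n m (λ x x′ → g (embed x) * χ G (singleton G (embed x)) x′) ⟩
    sumᴷ (suc q) (λ x → sum⊎ n m (λ x′ → g (embed x) * χ G (singleton G (embed x)) x′))
      ≡⟨ sumᴷ-cong (λ x → sum-point-mass G (g (embed x)) (embed x)) ⟩
    sumᴷ (suc q) (g ∘ embed)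
      ∎
    where
    open ≡-Reasoning
    decompose : ∀ x′ → g x′ ≡ sumᴷ (suc q) (λ x → g (embed x) * χ G (singleton G (embed x)) x′)
    decompose x′ with locate x′
    ... | inside y refl = sym (trans
      (sumᴷ-single _ y (λ x x≢y → trans (cong (g (embed x) *_) (χ-singleton-≢ G (x≢y ∘ embed-injective)))
                                        (ℚ.*-zeroʳ (g (embed x)))))
      (trans (cong (g (embed y) *_) (χ-singleton-self G (embed y))) (ℚ.*-identityʳ (g (embed y)))))
    ... | outside x′∉H = trans (g-off x′ x′∉H) (sym (sumᴷ-zero (λ x →
      trans (cong (g (embed x) *_) (χ-singleton-≢ G (λ x↦x′ → x′∉H (subst InH′ x↦x′ (embed-InH x)))))
            (ℚ.*-zeroʳ (g (embed x))))))

  _∪_ : (Elt G → Bool) → (Elt G → Bool) → Elt G → Bool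
  (T ∪ T′) x′ = T x′ Bool.∨ T′ x′

  ∪-true : ∀ T T′ x′ → (T ∪ T′) x′ ≡ true → T x′ ≡ true ⊎ T′ x′ ≡ true
  ∪-true T T′ x′ with T x′
  ... | true  = λ _ → inj₁ refl
  ... | false = inj₂

  insert-matching : ∀ o S → Independentᴷ S →
    (∀ x → S x ≡ true → ¬ Adj G o (embed x) × ¬ Adj G (embed x) o) → TotalMatching G (singleton G o ∪ lift S)
  insert-matching o S S-indep o≁S x′ y′ x′∈ y′∈ x′≢y′
    with ∪-true (singleton G o) (lift S) x′ x′∈ | ∪-true (singleton G o) (lift S) y′ y′∈
  ... | inj₁ o≡x′ | inj₁ o≡y′ =
    ⊥-elim (x′≢y′ (trans (sym (does-sound (_≟ᴱ_ G o x′) o≡x′)) (does-sound (_≟ᴱ_ G o y′) o≡y′)))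
  ... | inj₂ x′∈S | inj₂ y′∈S = lift-matching S S-indep x′ y′ x′∈S y′∈S x′≢y′
  ... | inj₁ o≡x′ | inj₂ y′∈S with does-sound (_≟ᴱ_ G o x′) o≡x′ | lift-true S y′ y′∈S
  ...   | refl | y , refl , Sy = proj₁ (o≁S y Sy)
  insert-matching o S S-indep o≁S x′ y′ x′∈ y′∈ x′≢y′
    | inj₂ x′∈S | inj₁ o≡y′ with does-sound (_≟ᴱ_ G o y′) o≡y′ | lift-true S x′ x′∈S
  ...   | refl | x , refl , Sx = proj₂ (o≁S x Sx)

  both-ends-in-H : ∀ {ε i j} → Endpoint G (a i) ε → Endpoint G (b j) ε → InH′ (inj₂ ε)
  both-ends-in-H {i = i} {j} (inj₁ s≡a) (inj₂ t≡b) = (inj₁ i , sym s≡a) , (inj₂ j , sym t≡b)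
  both-ends-in-H {i = i} {j} (inj₂ t≡a) (inj₁ s≡b) = (inj₂ j , sym s≡b) , (inj₁ i , sym t≡a)
  both-ends-in-H (inj₁ s≡a) (inj₁ s≡b) = ⊥-elim (a≢b (trans (sym s≡a) s≡b))
  both-ends-in-H (inj₂ t≡a) (inj₂ t≡b) = ⊥-elim (a≢b (trans (sym t≡a) t≡b))

  -- An edge outside H meets at most one side of H; avoided ε is a side it does not meet.
  avoided : Fin m → Side
  avoided ε = side (Fin.any? (λ j → Endpoint? G (b j) ε))
    where
    side : Dec (∃[ j ] Endpoint G (b j) ε) → Side
    side (yes _) = L
    side (no _)  = R

  avoided-nonadjacent : ∀ ε → ¬ InH′ (inj₂ ε) → ∀ x → full (avoided ε) x ≡ true →
    ¬ Adj G (inj₂ ε) (embed x) × ¬ Adj G (embed x) (inj₂ ε)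
  avoided-nonadjacent ε ε∉H with Fin.any? (λ j → Endpoint? G (b j) ε)
  ... | yes (j , bⱼ-end) = λ where
    (left i) _ → let ¬aᵢ-end = λ aᵢ-end → ε∉H (both-ends-in-H aᵢ-end bⱼ-end) in ¬aᵢ-end , ¬aᵢ-end
  ... | no ¬right = λ where
    (right j) _ → let ¬bⱼ-end = λ bⱼ-end → ¬right (j , bⱼ-end) in ¬bⱼ-end , ¬bⱼ-end

  faceMatchingAt : ∀ {x′} → Location x′ → Elt G → Bool
  faceMatchingAt (inside x _)             = lift (faceSet x)
  faceMatchingAt {inj₁ v} (outside _) = singleton G (inj₁ v) ∪ lift diagonal
  faceMatchingAt {inj₂ ε} (outside _) = singleton G (inj₂ ε) ∪ lift (full (avoided ε))

  faceMatching : Elt G → Elt G → Bool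
  faceMatching x′ = faceMatchingAt (locate x′)

  diagonal-nonadjacent : ∀ v → ¬ InHV G (suc q) f v → ∀ x → diagonal x ≡ true →
    ¬ Adj G (inj₁ v) (embed x) × ¬ Adj G (embed x) (inj₁ v)
  diagonal-nonadjacent v v∉H (edge k l) _ = v-not-end , v-not-end
    where
    v-not-end : ¬ Endpoint G v (e k l)
    v-not-end ep = v∉H (⊎.[ (λ aₖ≡v → inj₁ k , aₖ≡v) , (λ bₗ≡v → inj₂ l , bₗ≡v) ]′ (e-endpoint ep))

  faceMatching-matching : ∀ x′ → TotalMatching G (faceMatching x′)
  faceMatching-matching x′ = matchingAt (locate x′)
    where
    matchingAt : ∀ {x′} (ℓ : Location x′) → TotalMatching G (faceMatchingAt ℓ)
    matchingAt (inside x _) = lift-matching (faceSet x) (faceSet-indep x)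
    matchingAt {inj₁ v} (outside v∉H) =
      insert-matching (inj₁ v) diagonal diagonal-indep (diagonal-nonadjacent v v∉H)
    matchingAt {inj₂ ε} (outside ε∉H) =
      insert-matching (inj₂ ε) (full (avoided ε)) (full-indep (avoided ε)) (avoided-nonadjacent ε ε∉H)

  faceMatching-size : ∀ x′ → sumᴷ (suc q) (ind ∘ faceMatching x′ ∘ embed) ≡ ℕtoℚ (suc q)
  faceMatching-size x′ = sizeAt (locate x′)
    where
    outside-embed : ∀ o → ¬ InH′ o → ∀ S y → (singleton G o ∪ lift S) (embed y) ≡ S y
    outside-embed o o∉H S y =
      cong₂ Bool._∨_ (dec-false (_≟ᴱ_ G o (embed y)) (λ o≡y → o∉H (subst InH′ (sym o≡y) (embed-InH y))))
                     (lift-embed S y)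
    sizeAt : ∀ {x′} (ℓ : Location x′) → sumᴷ (suc q) (ind ∘ faceMatchingAt ℓ ∘ embed) ≡ ℕtoℚ (suc q)
    sizeAt (inside x _) = trans (sumᴷ-cong (cong ind ∘ lift-embed (faceSet x))) (count-faceSet x)
    sizeAt {inj₁ v} (outside v∉H) =
      trans (sumᴷ-cong (cong ind ∘ outside-embed (inj₁ v) v∉H diagonal)) (count-diagonal (suc q))
    sizeAt {inj₂ ε} (outside ε∉H) =
      trans (sumᴷ-cong (cong ind ∘ outside-embed (inj₂ ε) ε∉H (full (avoided ε)))) (count-full (suc q) (avoided ε))

  faceMatching-embed : ∀ x y → faceMatching (embed x) (embed y) ≡ faceSet x y
  faceMatching-embed x y = embedAt (locate (embed x)) refl
    where
    embedAt : ∀ {x′} (ℓ : Location x′) → embed x ≡ x′ → faceMatchingAt ℓ (embed y) ≡ faceSet x y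
    embedAt (inside x₁ x₁↦x′) x↦x′ with refl ← embed-injective (trans x₁↦x′ (sym x↦x′)) = lift-embed (faceSet x) y
    embedAt (outside x′∉H) refl = ⊥-elim (x′∉H (embed-InH x))

  faceMatching-self : ∀ x′ → ¬ InH′ x′ → faceMatching x′ x′ ≡ true
  faceMatching-self x′ x′∉H = selfAt x′∉H (locate x′)
    where
    selfAt : ∀ {x′} → ¬ InH′ x′ → (ℓ : Location x′) → faceMatchingAt ℓ x′ ≡ true
    selfAt x′∉H (inside x refl) = ⊥-elim (x′∉H (embed-InH x))
    selfAt {inj₁ v} _ (outside _) = cong (Bool._∨ lift diagonal (inj₁ v)) (dec-true (_≟ᴱ_ G (inj₁ v) (inj₁ v)) refl)
    selfAt {inj₂ ε} _ (outside _) =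
      cong (Bool._∨ lift (full (avoided ε)) (inj₂ ε)) (dec-true (_≟ᴱ_ G (inj₂ ε) (inj₂ ε)) refl)

  faceMatching-outside : ∀ x′ y′ → ¬ InH′ y′ → x′ ≢ y′ → faceMatching x′ y′ ≡ false
  faceMatching-outside x′ y′ y′∉H x′≢y′ = outsideAt x′≢y′ (locate x′)
    where
    outsideAt : ∀ {x′} → x′ ≢ y′ → (ℓ : Location x′) → faceMatchingAt ℓ y′ ≡ false
    outsideAt _ (inside x _) = lift-outside (faceSet x) y′∉H
    outsideAt {inj₁ v} v≢y′ (outside _) =
      cong₂ Bool._∨_ (dec-false (_≟ᴱ_ G (inj₁ v) y′) v≢y′) (lift-outside diagonal y′∉H)
    outsideAt {inj₂ ε} ε≢y′ (outside _) =
      cong₂ Bool._∨_ (dec-false (_≟ᴱ_ G (inj₂ ε) y′) ε≢y′) (lift-outside (full (avoided ε)) y′∉H)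

  faceMatchings-independent : LinIndep (n ℕ.+ m) (Elt G) (χ G ∘ faceMatching ∘ splitAt n)
  faceMatchings-independent μ μχ≡0 k = trans (cong μ (sym (Fin.join-splitAt n m k))) (ν≡0 (splitAt n k))
    where
    ν : Elt G → ℚ
    ν x′ = μ (join n m x′)
    νχ≡0 : ∀ y′ → sum⊎ n m (λ x′ → ν x′ * χ G (faceMatching x′) y′) ≡ 0ℚ
    νχ≡0 y′ = begin
      sum⊎ n m (λ x′ → ν x′ * χ G (faceMatching x′) y′)
        ≡⟨ sum⊎-cong (λ x′ → cong (λ z → ν x′ * χ G (faceMatching z) y′) (Fin.splitAt-join n m x′)) ⟨
      sum⊎ n m (λ x′ → ν x′ * χ G (faceMatching (splitAt n (join n m x′))) y′)
        ≡⟨ sum-↑ n m (λ k → μ k * χ G (faceMatching (splitAt n k)) y′) ⟨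
      sumFin (n ℕ.+ m) (λ k → μ k * χ G (faceMatching (splitAt n k)) y′)
        ≡⟨ μχ≡0 y′ ⟩
      0ℚ ∎
      where open ≡-Reasoning
    -- Outside H, only the matching chosen for y′ itself contains y′.
    ν-outside : ∀ y′ → ¬ InH′ y′ → ν y′ ≡ 0ℚ
    ν-outside y′ y′∉H = begin
      ν y′                                             ≡⟨ ℚ.*-identityʳ (ν y′) ⟨
      ν y′ * 1ℚ                                        ≡⟨ cong (λ t → ν y′ * ind t) (faceMatching-self y′ y′∉H) ⟨
      ν y′ * χ G (faceMatching y′) y′                 ≡⟨ sum⊎-single _ y′ others ⟨
      sum⊎ n m (λ x′ → ν x′ * χ G (faceMatching x′) y′) ≡⟨ νχ≡0 y′ ⟩
      0ℚ                                               ∎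
      where
      open ≡-Reasoning
      others : ∀ x′ → x′ ≢ y′ → ν x′ * χ G (faceMatching x′) y′ ≡ 0ℚ
      others x′ x′≢y′ =
        trans (cong (λ t → ν x′ * ind t) (faceMatching-outside x′ y′ y′∉H x′≢y′)) (ℚ.*-zeroʳ (ν x′))
    ν-inside : ∀ x → ν (embed x) ≡ 0ℚ
    ν-inside = faceSets-independent (ν ∘ embed) λ y → begin
      sumᴷ (suc q) (λ x → ν (embed x) * ind (faceSet x y))
        ≡⟨ sumᴷ-cong (λ x → cong (λ t → ν (embed x) * ind t) (faceMatching-embed x y)) ⟨
      sumᴷ (suc q) (λ x → ν (embed x) * χ G (faceMatching (embed x)) (embed y))
        ≡⟨ sum-over-H (λ x′ → ν x′ * χ G (faceMatching x′) (embed y))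
                      (λ x′ x′∉H → trans (cong (_* χ G (faceMatching x′) (embed y)) (ν-outside x′ x′∉H))
                                                     (ℚ.*-zeroˡ (χ G (faceMatching x′) (embed y)))) ⟨
      sum⊎ n m (λ x′ → ν x′ * χ G (faceMatching x′) (embed y))
        ≡⟨ νχ≡0 (embed y) ⟩
      0ℚ ∎
      where open ≡-Reasoning
    ν≡0 : ∀ x′ → ν x′ ≡ 0ℚ
    ν≡0 x′ with locate x′
    ... | inside x refl = ν-inside x
    ... | outside x′∉H  = ν-outside x′ x′∉H

  module _ (c : Pt G) (c-H : ∀ x′ → (InH′ x′ → c x′ ≡ 1ℚ) × (¬ InH′ x′ → c x′ ≡ 0ℚ)) where

    dot-c-χ : ∀ T → dot G c (χ G T) ≡ sumᴷ (suc q) (ind ∘ T ∘ embed)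
    dot-c-χ T = trans
      (sum-over-H (λ x′ → c x′ * χ G T x′)
                  (λ x′ x′∉H → trans (cong (_* χ G T x′) (proj₂ (c-H x′) x′∉H)) (ℚ.*-zeroˡ (χ G T x′))))
      (sumᴷ-cong (λ x → trans (cong (_* χ G T (embed x)) (proj₁ (c-H (embed x)) (embed-InH x)))
                             (ℚ.*-identityˡ (χ G T (embed x)))))

    biclique-valid : ValidIneq G c (ℕtoℚ (suc q))
    biclique-valid = valid-of-matchings G c (ℕtoℚ (suc q)) λ T T-matching →
      subst (_≤ℚ ℕtoℚ (suc q)) (sym (dot-c-χ T)) (independentᴷ-size (T ∘ embed) (restrict-matching T T-matching))

    faceMatching-tight : ∀ x′ → dot G c (χ G (faceMatching x′)) ≡ ℕtoℚ (suc q)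
    faceMatching-tight x′ = trans (dot-c-χ (faceMatching x′)) (faceMatching-size x′)

    dot-c-c≢0 : dot G c c ≢ 0ℚ
    dot-c-c≢0 cc≡0 = 1≢0 (ℚ.≤-antisym (subst (1ℚ ≤ℚ_) cc≡0 1≤cc) (ℚ.nonNegative⁻¹ 1ℚ))
      where
      1≢0 : 1ℚ ≢ 0ℚ
      1≢0 ()
      c²≥0 : ∀ x′ → 0ℚ ≤ℚ c x′ * c x′
      c²≥0 x′ with locate x′
      ... | inside x refl = subst (λ z → 0ℚ ≤ℚ z * z) (sym (proj₁ (c-H x′) (embed-InH x))) (ℚ.nonNegative⁻¹ 1ℚ)
      ... | outside x′∉H  = subst (λ z → 0ℚ ≤ℚ z * z) (sym (proj₂ (c-H x′) x′∉H)) ℚ.≤-refl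
      1≤cc : 1ℚ ≤ℚ dot G c c
      1≤cc = subst (λ z → z * z ≤ℚ dot G c c) (proj₁ (c-H (embed (left zero))) (embed-InH (left zero)))
               (term≤sum⊎ (λ x′ → c x′ * c x′) (embed (left zero)) c²≥0)

mainTheorem3 : (G : Graph) (r : ℕ) → 1 ≤ r →
    (f : Fin r ⊎ Fin r → Fin (Graph.n G)) → InducedKrr G r f →
    (c : Pt G) → (∀ a → (InH G r f a → c a ≡ 1ℚ) × (¬ InH G r f a → c a ≡ 0ℚ)) →
    IsFacet G c (ℕtoℚ r)
mainTheorem3 G zero () f H c c-H
mainTheorem3 G@record { n = zero } (suc q) _ f H c c-H with () ← f (inj₁ zero)
mainTheorem3 G@record { n = suc n′ ; m = m } (suc q) _ f H c c-H =
  facet-of-independent-matchings G c (ℕtoℚ (suc q)) (n′ ℕ.+ m) refl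
    (biclique-valid c c-H) (dot-c-c≢0 c c-H)
    (faceMatching ∘ splitAt (suc n′)) (faceMatching-matching ∘ splitAt (suc n′))
    (faceMatching-tight c c-H ∘ splitAt (suc n′)) faceMatchings-independent
  where open InducedBiclique G q f H
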